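{- Let $M=(X,rk)$ be a loopless matroid and write its Tutte polynomial as $T_M(x,y)=\sum_{i,j\ge0}t_{i,j}x^iy^j$. Then for all non-negative integers $i,j$, \[t_{i,j}=(-1)^{rk(M)+i+j}\sum_{F\in\mathcal{F}(M)}\left(\sum_{F'\in\mathcal{F}(M/F)}\mu(\emptyset,F')\binom{rk(M)-rk(F\cup F')}{i}\right)\left(\sum_{A\subseteq F}(-1)^{|A|}\binom{|A|-rk(A)}{j}\right),\] where $\mu$ denotes the Möbius function of the lattice of flats $\mathcal{F}(M/F)$.
   Context: A matroid $(X,rk)$ is a finite set with rank function $rk:2^X\to\mathbb{Z}_{\ge0}$ satisfying $rk(A)\le|A|$, monotonicity and submodularity; $rk(M)=rk(X)$; loopless means no $e$ with $rk(\{e\})=0$. The Tutte polynomial is $T_M(x,y)=\sum_{A\subseteq X}(x-1)^{rk(X)-rk(A)}(y-1)^{|A|-rk(A)}$. A flat is a set $F$ with $\{e:rk(F\cup\{e\})=rk(F)\}=F$; $\mathcal{F}(N)$ is the lattice of flats of a matroid $N$ under inclusion. The contraction $M/F$ is the matroid on $X\setminus F$ with $rk_{M/F}(A)=rk(A\cup F)-rk(F)$. The Möbius function $\mu$ of a finite poset satisfies $\sum_{x\le y\le z}\mu(x,y)=\delta(x,z)$ for $x\le z$ and $\mu(x,z)=0$ otherwise. -}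

module Defs where

open import Data.Bool using (Bool; true; false; _∧_; _∨_; not; if_then_else_)
open import Data.Nat using (ℕ; zero; suc; _≤_; _∸_) renaming (_+_ to _+ℕ_; _≡ᵇ_ to _==ℕ_)
open import Data.Nat.Combinatorics using (_C_)
open import Data.Integer using (ℤ; +_; -_; _^_) renaming (_+_ to _+ℤ_; _*_ to _*ℤ_)
open import Data.Fin using (Fin)
open import Data.Fin.Subset using (Subset; _⊆_; _∪_; _∩_; ⁅_⁆; ⊤; ⊥; ∣_∣)
open import Data.Vec using (Vec; []; _∷_; lookup; zipWith)
open import Data.List using (List; []; _∷_; map; foldr; filter; _++_)
open import Data.List.Base using (allFin)
open import Relation.Binary.PropositionalEquality using (_≡_; _≢_)
open import Relation.Nullary using (¬_)
import Data.Bool as B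

record Matroid (n : ℕ) : Set where
  field
    rk      : Subset n → ℕ
    rk-card : ∀ A → rk A ≤ ∣ A ∣
    rk-mono : ∀ {A B} → A ⊆ B → rk A ≤ rk B
    rk-sub  : ∀ A B → rk (A ∪ B) +ℕ rk (A ∩ B) ≤ rk A +ℕ rk B
open Matroid public

rkM : ∀ {n} → Matroid n → ℕ
rkM M = rk M ⊤

Loopless : ∀ {n} → Matroid n → Set
Loopless {n} M = ∀ (e : Fin n) → rk M ⁅ e ⁆ ≢ 0

sumℤ : List ℤ → ℤ
sumℤ = foldr _+ℤ_ (+ 0)

allSubsets : (n : ℕ) → List (Subset n)
allSubsets zero    = [] ∷ []
allSubsets (suc n) = map (false ∷_) (allSubsets n) ++ map (true ∷_) (allSubsets n)

allB : ∀ {n} → Vec Bool n → Bool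
allB []       = true
allB (b ∷ bs) = b ∧ allB bs

subB : ∀ {n} → Subset n → Subset n → Bool
subB A B = allB (zipWith (λ a b → not a ∨ b) A B)

eqB : ∀ {n} → Subset n → Subset n → Bool
eqB A B = subB A B ∧ subB B A

sumSubsetsOf : ∀ {n} → Subset n → (Subset n → ℤ) → ℤ
sumSubsetsOf {n} F f = sumℤ (map f (filter (λ A → subB A F B.≟ true) (allSubsets n)))

sgn : ℕ → ℤ
sgn k = (- (+ 1)) ^ k

isFlat : ∀ {n} → Matroid n → Subset n → Bool
isFlat {n} M F =
  allB' (allFin n)
  where
    allB' : List (Fin n) → Bool
    allB' []       = true
    allB' (e ∷ es) =
      (if (rk M (F ∪ ⁅ e ⁆) ==ℕ rk M F) then lookup F e else not (lookup F e)) ∧ allB' es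

flats : ∀ {n} → Matroid n → List (Subset n)
flats {n} M = filter (λ F → isFlat M F B.≟ true) (allSubsets n)

-- Contraction M/F: ground set X \ F (subsets of X \ F are represented as
-- subsets of Fin n disjoint from F), rank rk_{M/F}(A) = rk(A ∪ F) - rk(F).

rkC : ∀ {n} → Matroid n → Subset n → Subset n → ℕ
rkC M F A = rk M (A ∪ F) ∸ rk M F

isFlatC : ∀ {n} → Matroid n → Subset n → Subset n → Bool
isFlatC {n} M F G = disjoint ∧ closed (allFin n)
  where
    disjoint : Bool
    disjoint = allB (zipWith (λ f g → not (f ∧ g)) F G)
    closed : List (Fin n) → Bool
    closed []       = true
    closed (e ∷ es) =
      (if lookup F e then true
       else (if (rkC M F (G ∪ ⁅ e ⁆) ==ℕ rkC M F G) then lookup G e else not (lookup G e)))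
      ∧ closed es

flatsC : ∀ {n} → Matroid n → Subset n → List (Subset n)
flatsC {n} M F = filter (λ G → isFlatC M F G B.≟ true) (allSubsets n)

-- μ F : the Möbius function of the lattice of flats 𝓕(M/F) (ordered by ⊆),
-- for every flat F of M.
IsMobius : ∀ {n} → Matroid n → (Subset n → Subset n → Subset n → ℤ) → Set
IsMobius M μ =
  ∀ F → isFlat M F ≡ true →
  ∀ G H → isFlatC M F G ≡ true → isFlatC M F H ≡ true →
    (subB G H ≡ true →
       sumℤ (map (μ F G) (filter (λ K → (subB G K ∧ subB K H) B.≟ true) (flatsC M F)))
         ≡ (if eqB G H then + 1 else + 0))
  × (¬ (subB G H ≡ true) → μ F G H ≡ + 0)
  where open import Data.Product using (_×_)

-- Polynomials as coefficient lists (constant term first)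

module PolyOps {A : Set} (0# 1# : A) (_+_ _*_ : A → A → A) where
  addP : List A → List A → List A
  addP []       q        = q
  addP p        []       = p
  addP (a ∷ p)  (b ∷ q)  = (a + b) ∷ addP p q

  mulP : List A → List A → List A
  mulP []      q = []
  mulP (a ∷ p) q = addP (map (a *_) q) (0# ∷ mulP p q)

  powP : List A → ℕ → List A
  powP p zero    = 1# ∷ []
  powP p (suc k) = mulP p (powP p k)

  coeffP : List A → ℕ → A
  coeffP []      _       = 0#
  coeffP (a ∷ p) zero    = a
  coeffP (a ∷ p) (suc i) = coeffP p i

PolyX : Set
PolyX = List ℤ
module PX = PolyOps (+ 0) (+ 1) _+ℤ_ _*ℤ_

-- ℤ[x][y] = ℤ[x,y] : list of coefficients of y^j, each in ℤ[x]
PolyXY : Set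
PolyXY = List PolyX
module PXY = PolyOps [] (+ 1 ∷ []) PX.addP PX.mulP

xMinus1 : PolyXY
xMinus1 = ((- (+ 1)) ∷ + 1 ∷ []) ∷ []

yMinus1 : PolyXY
yMinus1 = ((- (+ 1)) ∷ []) ∷ (+ 1 ∷ []) ∷ []

tutte : ∀ {n} → Matroid n → PolyXY
tutte {n} M =
  foldr PXY.addP []
    (map (λ A → PXY.mulP (PXY.powP xMinus1 (rkM M ∸ rk M A))
                          (PXY.powP yMinus1 (∣ A ∣ ∸ rk M A)))
         (allSubsets n))

tutteCoeff : ∀ {n} → Matroid n → ℕ → ℕ → ℤ
tutteCoeff M i j = PX.coeffP (PXY.coeffP (tutte M) j) i

binomℤ : ℕ → ℕ → ℤ
binomℤ a i = + (a C i)

-- Expanding (x-1)^a (y-1)^b, the coefficient t_ij is (-1)^(r+i+j) times the sum over all A of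
-- C(r - rk A, i) (-1)^|A| C(|A| - rk A, j); the signs match because 2 rk A is even. Grouping each A
-- under the flats F containing it, it remains to see that the inner sums α(F) of the formula satisfy
-- Σ_{F ⊇ A} α(F) = C(r - rk A, i). Flats of M/F are the flats of M above F (via G ↦ F ∪ G), so
-- α(F) = Σ_{H ⊇ F} μ(F,H) C(r - rk H, i) for the Möbius function μ of 𝓕(M), and the sum over F ⊇ A,
-- that is over F ⊇ cl A, collapses by Möbius inversion to C(r - rk (cl A), i) = C(r - rk A, i).
-- The hypothesis gives μ only through its sums Σ_{G ⊆ K ⊆ H} μ(G,K); the sums Σ_{G ⊆ K ⊆ H} μ(K,H)
-- needed here are derived by induction on |H| - |G|.

module Submission where

open import Defs
open import Data.Bool using (Bool; true; false; _∧_; _∨_; not; if_then_else_)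
import Data.Bool as B
import Data.Bool.Properties as BP
open import Data.Bool.ListAction using (all)
open import Data.Nat using (ℕ; zero; suc; _≤_; _<_; _∸_; s≤s) renaming (_+_ to _+ℕ_; _≡ᵇ_ to _==ℕ_)
import Data.Nat.Properties as NP
open import Data.Nat.Combinatorics using (_C_; nCk+nC[k+1]≡[n+1]C[k+1])
open import Data.Nat.Induction using (<-wellFounded)
open import Data.Integer using (ℤ; +_; -_) renaming (_+_ to _+ℤ_; _*_ to _*ℤ_)
import Data.Integer.Properties as ZP
open import Data.Integer.Tactic.RingSolver using (solve-∀)
import Data.Nat.Tactic.RingSolver as ℕ-Solver
open import Algebra.Properties.CommutativeSemigroup ZP.+-commutativeSemigroup using (interchange)
import Algebra.Bundles
import Algebra.Properties.Group
open import Algebra.Properties.Loop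
  (Algebra.Properties.Group.loop (Algebra.Bundles.AbelianGroup.group ZP.+-0-abelianGroup))
  using (identityˡ-unique)
open import Data.Fin using (Fin; zero; suc) renaming (_≟_ to _≟ᶠ_)
open import Data.Fin.Subset using (Subset; _∪_; _∩_; _─_; _-_; ⁅_⁆; ⊤; ⊥; ∣_∣)
  renaming (_⊆_ to _⊆ₛ_)
import Data.Fin.Subset.Properties as SP
open import Data.Vec using (_∷_; []; lookup; tabulate; zipWith)
import Data.Vec.Properties as VP
open import Data.List using (List; []; _∷_; map; foldr; filter; _++_; allFin)
import Data.List as L
open import Data.Product using (_×_; _,_; proj₁)
open import Data.Empty using (⊥-elim)
open import Function.Bundles using (mk⇔; Equivalence)
open import Induction.WellFounded using (Acc; acc)
open import Relation.Nullary using (yes; no)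
open import Relation.Binary.PropositionalEquality

∑ : {A : Set} → List A → (A → ℤ) → ℤ
∑ L f = sumℤ (map f L)

when : Bool → ℤ → ℤ
when b x = if b then x else + 0

private variable
  I I′ : Set

∑-cong : {f g : I → ℤ} → (∀ x → f x ≡ g x) → ∀ L → ∑ L f ≡ ∑ L g
∑-cong h []      = refl
∑-cong h (x ∷ L) = cong₂ _+ℤ_ (h x) (∑-cong h L)

∑-zero : (L : List I) → ∑ L (λ _ → + 0) ≡ + 0
∑-zero []      = refl
∑-zero (x ∷ L) = trans (ZP.+-identityˡ _) (∑-zero L)

∑-zero′ : {f : I → ℤ} → (∀ x → f x ≡ + 0) → ∀ L → ∑ L f ≡ + 0
∑-zero′ h L = trans (∑-cong h L) (∑-zero L)

∑-+ : (f g : I → ℤ) (L : List I) → ∑ L (λ x → f x +ℤ g x) ≡ ∑ L f +ℤ ∑ L g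
∑-+ f g []      = refl
∑-+ f g (x ∷ L) = trans (cong (f x +ℤ g x +ℤ_) (∑-+ f g L)) (interchange (f x) (g x) (∑ L f) (∑ L g))

∑-*ˡ : (c : ℤ) (f : I → ℤ) (L : List I) → ∑ L (λ x → c *ℤ f x) ≡ c *ℤ ∑ L f
∑-*ˡ c f []      = sym (ZP.*-zeroʳ c)
∑-*ˡ c f (x ∷ L) = trans (cong (c *ℤ f x +ℤ_) (∑-*ˡ c f L)) (sym (ZP.*-distribˡ-+ c (f x) (∑ L f)))

∑-*ʳ : (c : ℤ) (f : I → ℤ) (L : List I) → ∑ L (λ x → f x *ℤ c) ≡ ∑ L f *ℤ c
∑-*ʳ c f L = begin
  ∑ L (λ x → f x *ℤ c)  ≡⟨ ∑-cong (λ x → ZP.*-comm (f x) c) L ⟩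
  ∑ L (λ x → c *ℤ f x)  ≡⟨ ∑-*ˡ c f L ⟩
  c *ℤ ∑ L f            ≡⟨ ZP.*-comm c (∑ L f) ⟩
  ∑ L f *ℤ c            ∎
  where open ≡-Reasoning

∑-swap : (L : List I) (K : List I′) (f : I → I′ → ℤ) →
  ∑ L (λ x → ∑ K (f x)) ≡ ∑ K (λ y → ∑ L (λ x → f x y))
∑-swap []      K f = sym (∑-zero K)
∑-swap (x ∷ L) K f =
  trans (cong (∑ K (f x) +ℤ_) (∑-swap L K f)) (sym (∑-+ (f x) (λ y → ∑ L (λ x → f x y)) K))

∑-++ : (L K : List I) (f : I → ℤ) → ∑ (L ++ K) f ≡ ∑ L f +ℤ ∑ K f
∑-++ []      K f = sym (ZP.+-identityˡ (∑ K f))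
∑-++ (x ∷ L) K f = trans (cong (f x +ℤ_) (∑-++ L K f)) (sym (ZP.+-assoc (f x) (∑ L f) (∑ K f)))

∑-map : (g : I → I′) (L : List I) (f : I′ → ℤ) → ∑ (map g L) f ≡ ∑ L (λ x → f (g x))
∑-map g []      f = refl
∑-map g (x ∷ L) f = cong (f (g x) +ℤ_) (∑-map g L f)

∑-filter : (p : I → Bool) (f : I → ℤ) (L : List I) →
  ∑ (filter (λ x → p x B.≟ true) L) f ≡ ∑ L (λ x → when (p x) (f x))
∑-filter p f []      = refl
∑-filter p f (x ∷ L) with p x
... | true  = cong (f x +ℤ_) (∑-filter p f L)
... | false = trans (∑-filter p f L) (sym (ZP.+-identityˡ _))

when-∑ : (b : Bool) (f : I → ℤ) (L : List I) → when b (∑ L f) ≡ ∑ L (λ x → when b (f x))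
when-∑ true  f L = refl
when-∑ false f L = sym (∑-zero L)

when-*ʳ : ∀ b x y → when b x *ℤ y ≡ when b (x *ℤ y)
when-*ʳ true  x y = refl
when-*ʳ false x y = ZP.*-zeroˡ y

when-*ˡ : ∀ b x y → x *ℤ when b y ≡ when b (x *ℤ y)
when-*ˡ true  x y = refl
when-*ˡ false x y = ZP.*-zeroʳ x

when-∧ : ∀ a b x → when a (when b x) ≡ when (a ∧ b) x
when-∧ true  b x = refl
when-∧ false b x = refl

when-comm : ∀ a b x → when a (when b x) ≡ when b (when a x)
when-comm true  b     x = refl
when-comm false true  x = refl
when-comm false false x = refl

when-zero : ∀ b → when b (+ 0) ≡ + 0
when-zero true  = refl
when-zero false = refl

when-true : ∀ {b} x → b ≡ true → when b x ≡ x
when-true x refl = refl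

when-false : ∀ {b} x → b ≡ false → when b x ≡ + 0
when-false x refl = refl

when-cong : ∀ {b x y} → (b ≡ true → x ≡ y) → when b x ≡ when b y
when-cong {true}  h = h refl
when-cong {false} h = refl

≡true-ext : {a b : Bool} → (a ≡ true → b ≡ true) → (b ≡ true → a ≡ true) → a ≡ b
≡true-ext to from = BP.⇔→≡ (mk⇔ to from)

false≢true : false ≢ true
false≢true ()

≢true⇒≡false : ∀ {b} → b ≢ true → b ≡ false
≢true⇒≡false {true}  h = ⊥-elim (h refl)
≢true⇒≡false {false} h = refl

∧-trueˡ : ∀ {a b} → a ∧ b ≡ true → a ≡ true
∧-trueˡ {true} p = refl

∧-trueʳ : ∀ {a b} → a ∧ b ≡ true → b ≡ true
∧-trueʳ {true} p = p

∧-true : ∀ {a b} → a ≡ true → b ≡ true → a ∧ b ≡ true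
∧-true refl refl = refl

==ℕ-complete : ∀ {x y} → x ≡ y → (x ==ℕ y) ≡ true
==ℕ-complete {x} refl = Equivalence.to BP.T-≡ (NP.≡⇒≡ᵇ x x refl)

==ℕ-sound : ∀ {x y} → (x ==ℕ y) ≡ true → x ≡ y
==ℕ-sound {x} {y} p = NP.≡ᵇ⇒≡ x y (Equivalence.from BP.T-≡ p)

==ℕ-false : ∀ {x y} → x ≢ y → (x ==ℕ y) ≡ false
==ℕ-false ne = ≢true⇒≡false (λ p → ne (==ℕ-sound p))

if-true : ∀ {b : Bool} {A : Set} {x y : A} → b ≡ true → (if b then x else y) ≡ x
if-true refl = refl

if-false : ∀ {b : Bool} {A : Set} {x y : A} → b ≡ false → (if b then x else y) ≡ y
if-false refl = refl

_==_ : ∀ {n} → Subset n → Subset n → Bool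
[]      == []      = true
(a ∷ A) == (b ∷ B) = not (a B.xor b) ∧ (A == B)

==-refl : ∀ {n} (A : Subset n) → A == A ≡ true
==-refl []          = refl
==-refl (true ∷ A)  = ==-refl A
==-refl (false ∷ A) = ==-refl A

==-sound : ∀ {n} {A B : Subset n} → A == B ≡ true → A ≡ B
==-sound {A = []}        {[]}        p = refl
==-sound {A = true ∷ A}  {true ∷ B}  p = cong (true ∷_) (==-sound p)
==-sound {A = false ∷ A} {false ∷ B} p = cong (false ∷_) (==-sound p)

==-complete : ∀ {n} {A B : Subset n} → A ≡ B → A == B ≡ true
==-complete {A = A} refl = ==-refl A

==-sym : ∀ {n} (A B : Subset n) → A == B ≡ B == A
==-sym A B = ≡true-ext (λ p → ==-complete (sym (==-sound {A = A} {B} p)))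
                       (λ p → ==-complete (sym (==-sound {A = B} {A} p)))

∑-delta : ∀ n (X : Subset n) (f : Subset n → ℤ) → ∑ (allSubsets n) (λ H → when (H == X) (f H)) ≡ f X
∑-delta zero    []      f = ZP.+-identityʳ (f [])
∑-delta (suc n) (c ∷ X) f = begin
  ∑ (map (false ∷_) S ++ map (true ∷_) S) g
    ≡⟨ ∑-++ (map (false ∷_) S) (map (true ∷_) S) g ⟩
  ∑ (map (false ∷_) S) g +ℤ ∑ (map (true ∷_) S) g
    ≡⟨ cong₂ _+ℤ_ (∑-map (false ∷_) S g) (∑-map (true ∷_) S g) ⟩
  ∑ S (λ H → g (false ∷ H)) +ℤ ∑ S (λ H → g (true ∷ H))
    ≡⟨ split c ⟩
  f (c ∷ X) ∎
  where
  open ≡-Reasoning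
  S = allSubsets n
  g : Subset (suc n) → ℤ
  g H = when (H == (c ∷ X)) (f H)
  split : ∀ c → ∑ S (λ H → when ((false ∷ H) == (c ∷ X)) (f (false ∷ H)))
                 +ℤ ∑ S (λ H → when ((true ∷ H) == (c ∷ X)) (f (true ∷ H))) ≡ f (c ∷ X)
  split false = trans (cong₂ _+ℤ_ (∑-delta n X (λ H → f (false ∷ H))) (∑-zero S)) (ZP.+-identityʳ _)
  split true  = trans (cong₂ _+ℤ_ (∑-zero S) (∑-delta n X (λ H → f (true ∷ H)))) (ZP.+-identityˡ _)

∑-delta′ : ∀ n (X : Subset n) (f : Subset n → ℤ) → ∑ (allSubsets n) (λ H → when (X == H) (f H)) ≡ f X
∑-delta′ n X f = trans (∑-cong (λ H → cong (λ b → when b (f H)) (==-sym X H)) (allSubsets n)) (∑-delta n X f)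

Subset-ext : ∀ {n} {A B : Subset n} → (∀ e → lookup A e ≡ lookup B e) → A ≡ B
Subset-ext {A = []}    {[]}    h = refl
Subset-ext {A = a ∷ A} {b ∷ B} h = cong₂ _∷_ (h zero) (Subset-ext (λ e → h (suc e)))

lookup-∪ : ∀ {n} (A B : Subset n) e → lookup (A ∪ B) e ≡ lookup A e ∨ lookup B e
lookup-∪ A B e = VP.lookup-zipWith _∨_ e A B

lookup-∩ : ∀ {n} (A B : Subset n) e → lookup (A ∩ B) e ≡ lookup A e ∧ lookup B e
lookup-∩ A B e = VP.lookup-zipWith _∧_ e A B

lookup-─ : ∀ {n} (A B : Subset n) e → lookup (A ─ B) e ≡ lookup A e ∧ not (lookup B e)
lookup-─ (a ∷ A) (true ∷ B)  zero    = sym (BP.∧-zeroʳ a)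
lookup-─ (a ∷ A) (false ∷ B) zero    = sym (BP.∧-identityʳ a)
lookup-─ (a ∷ A) (b ∷ B)     (suc e) = lookup-─ A B e

lookup-⊥ : ∀ {n} (e : Fin n) → lookup ⊥ e ≡ false
lookup-⊥ e = VP.lookup-replicate e false

lookup-⊤ : ∀ {n} (e : Fin n) → lookup ⊤ e ≡ true
lookup-⊤ e = VP.lookup-replicate e true

lookup-⁅⁆-≡ : ∀ {n} (x : Fin n) → lookup ⁅ x ⁆ x ≡ true
lookup-⁅⁆-≡ zero    = refl
lookup-⁅⁆-≡ (suc x) = lookup-⁅⁆-≡ x

lookup-⁅⁆-≢ : ∀ {n} (x e : Fin n) → x ≢ e → lookup ⁅ x ⁆ e ≡ false
lookup-⁅⁆-≢ zero    zero    ne = ⊥-elim (ne refl)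
lookup-⁅⁆-≢ zero    (suc e) ne = lookup-⊥ e
lookup-⁅⁆-≢ (suc x) zero    ne = refl
lookup-⁅⁆-≢ (suc x) (suc e) ne = lookup-⁅⁆-≢ x e (λ eq → ne (cong suc eq))

lookup-⁅⁆⇒≡ : ∀ {n} (x e : Fin n) → lookup ⁅ x ⁆ e ≡ true → x ≡ e
lookup-⁅⁆⇒≡ x e p with x ≟ᶠ e
... | yes x≡e = x≡e
... | no  x≢e = ⊥-elim (false≢true (trans (sym (lookup-⁅⁆-≢ x e x≢e)) p))

infix 4 _⊑_

record _⊑_ {n} (A B : Subset n) : Set where
  constructor ⊑-pointwise
  field ⊑-at : ∀ e → lookup A e ≡ true → lookup B e ≡ true
open _⊑_

⊑⇒⊆ : ∀ {n} {A B : Subset n} → A ⊑ B → A ⊆ₛ B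
⊑⇒⊆ {B = B} h {x} x∈A = VP.lookup⇒[]= x B (⊑-at h x (VP.[]=⇒lookup x∈A))

⊑-refl : ∀ {n} (A : Subset n) → A ⊑ A
⊑-refl A = ⊑-pointwise λ e p → p

⊑-trans : ∀ {n} {A B D : Subset n} → A ⊑ B → B ⊑ D → A ⊑ D
⊑-trans h k = ⊑-pointwise λ e p → ⊑-at k e (⊑-at h e p)

⊑-antisym : ∀ {n} {A B : Subset n} → A ⊑ B → B ⊑ A → A ≡ B
⊑-antisym h k = Subset-ext (λ e → ≡true-ext (⊑-at h e) (⊑-at k e))

⊑-∪ˡ : ∀ {n} (A B : Subset n) → A ⊑ A ∪ B
⊑-∪ˡ A B = ⊑-pointwise λ e p → trans (lookup-∪ A B e) (cong (_∨ lookup B e) p)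

⊑-∪ʳ : ∀ {n} (A B : Subset n) → B ⊑ A ∪ B
⊑-∪ʳ A B = ⊑-pointwise λ e p →
  trans (lookup-∪ A B e) (trans (cong (lookup A e ∨_) p) (BP.∨-zeroʳ (lookup A e)))

∪-⊑ : ∀ {n} {A B D : Subset n} → A ⊑ D → B ⊑ D → A ∪ B ⊑ D
∪-⊑ {A = A} {B} h k = ⊑-pointwise at
  where
  at : ∀ e → lookup (A ∪ B) e ≡ true → _
  at e p with lookup A e in a
  ... | true  = ⊑-at h e a
  ... | false = ⊑-at k e (trans (sym (cong (_∨ lookup B e) a)) (trans (sym (lookup-∪ A B e)) p))

⊑-∩ : ∀ {n} {A B D : Subset n} → A ⊑ B → A ⊑ D → A ⊑ B ∩ D
⊑-∩ {B = B} {D} h k = ⊑-pointwise λ e p → trans (lookup-∩ B D e) (∧-true (⊑-at h e p) (⊑-at k e p))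

subB-sound : ∀ {n} {A B : Subset n} → subB A B ≡ true → A ⊑ B
subB-sound {A = A} {B} p = ⊑-pointwise (at A B p)
  where
  at : ∀ {k} (A B : Subset k) → subB A B ≡ true → ∀ e → lookup A e ≡ true → lookup B e ≡ true
  at (true ∷ A) (true ∷ B)  p zero    q = refl
  at (true ∷ A) (false ∷ B) () zero   q
  at (a ∷ A)    (b ∷ B)     p (suc e) q = at A B (∧-trueʳ {not a ∨ b} p) e q

subB-complete : ∀ {n} {A B : Subset n} → A ⊑ B → subB A B ≡ true
subB-complete {A = A} {B} h = go A B (⊑-at h)
  where
  head : ∀ a b → (a ≡ true → b ≡ true) → not a ∨ b ≡ true
  head true  b f = f refl
  head false b f = refl
  go : ∀ {k} (A B : Subset k) → (∀ e → lookup A e ≡ true → lookup B e ≡ true) → subB A B ≡ true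
  go []      []      h = refl
  go (a ∷ A) (b ∷ B) h = ∧-true (head a b (h zero)) (go A B (λ e → h (suc e)))

subB-refl : ∀ {n} (A : Subset n) → subB A A ≡ true
subB-refl A = subB-complete (⊑-refl A)

subB-trans : ∀ {n} {A B D : Subset n} → subB A B ≡ true → subB B D ≡ true → subB A D ≡ true
subB-trans {A = A} {B} {D} p q = subB-complete (⊑-trans (subB-sound {A = A} {B} p) (subB-sound {A = B} {D} q))

subB-antisym : ∀ {n} {A B : Subset n} → subB A B ≡ true → subB B A ≡ true → A ≡ B
subB-antisym p q = ⊑-antisym (subB-sound p) (subB-sound q)

subB-⊥ : ∀ {n} (X : Subset n) → subB ⊥ X ≡ true
subB-⊥ X = subB-complete {A = ⊥} {X} (⊑-pointwise λ e p → ⊥-elim (false≢true (trans (sym (lookup-⊥ e)) p)))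

eqB≡== : ∀ {n} (A B : Subset n) → eqB A B ≡ A == B
eqB≡== A B = ≡true-ext
  (λ p → ==-complete (subB-antisym {A = A} {B} (∧-trueˡ p) (∧-trueʳ {subB A B} p)))
  (λ p → subst (λ Z → eqB A Z ≡ true) (==-sound {A = A} {B} p) (∧-true (subB-refl A) (subB-refl A)))

∣∣-mono-⊑ : ∀ {n} {A B : Subset n} → A ⊑ B → ∣ A ∣ ≤ ∣ B ∣
∣∣-mono-⊑ h = SP.p⊆q⇒∣p∣≤∣q∣ (⊑⇒⊆ h)

∣∣-mono-⊏ : ∀ {n} {A B : Subset n} → A ⊑ B → A ≢ B → ∣ A ∣ < ∣ B ∣
∣∣-mono-⊏ {A = A} {B} h = go A B (⊑-at h)
  where
  go : ∀ {k} (A B : Subset k) → (∀ e → lookup A e ≡ true → lookup B e ≡ true) → A ≢ B → ∣ A ∣ < ∣ B ∣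
  go []          []          h ne = ⊥-elim (ne refl)
  go (true ∷ A)  (true ∷ B)  h ne = s≤s (go A B (λ e → h (suc e)) (λ q → ne (cong (true ∷_) q)))
  go (false ∷ A) (true ∷ B)  h ne = s≤s (∣∣-mono-⊑ {A = A} {B} (⊑-pointwise λ e → h (suc e)))
  go (false ∷ A) (false ∷ B) h ne = go A B (λ e → h (suc e)) (λ q → ne (cong (false ∷_) q))
  go (true ∷ A)  (false ∷ B) h ne = ⊥-elim (false≢true (h zero refl))

∑-reindex : ∀ n (p q : Subset n → Bool) (f g : Subset n → Subset n) (φ : Subset n → ℤ) →
  (∀ x → p x ≡ true → q (f x) ≡ true) → (∀ y → q y ≡ true → p (g y) ≡ true) →
  (∀ x → p x ≡ true → g (f x) ≡ x) → (∀ y → q y ≡ true → f (g y) ≡ y) →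
  ∑ (allSubsets n) (λ x → when (p x) (φ x)) ≡ ∑ (allSubsets n) (λ y → when (q y) (φ (g y)))
∑-reindex n p q f g φ pq qp gf fg = begin
  ∑ S (λ x → when (p x) (φ x))
    ≡⟨ ∑-cong (λ x → trans (cong (when (p x)) (sym (∑-delta n (f x) (λ _ → φ x)))) (when-∑ (p x) _ S)) S ⟩
  ∑ S (λ x → ∑ S (λ y → when (p x) (when (y == f x) (φ x))))
    ≡⟨ ∑-swap S S _ ⟩
  ∑ S (λ y → ∑ S (λ x → when (p x) (when (y == f x) (φ x))))
    ≡⟨ ∑-cong fibre S ⟩
  ∑ S (λ y → when (q y) (φ (g y))) ∎
  where
  open ≡-Reasoning
  S = allSubsets n
  fibre : ∀ y → ∑ S (λ x → when (p x) (when (y == f x) (φ x))) ≡ when (q y) (φ (g y))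
  fibre y with q y in qy
  ... | true  = trans (∑-cong single S) (∑-delta n (g y) φ)
    where
    single : ∀ x → when (p x) (when (y == f x) (φ x)) ≡ when (x == g y) (φ x)
    single x = trans (when-∧ (p x) _ _) (cong (λ b → when b (φ x)) (≡true-ext to from))
      where
      to : p x ∧ (y == f x) ≡ true → x == g y ≡ true
      to h = ==-complete (trans (sym (gf x (∧-trueˡ h))) (cong g (sym (==-sound {A = y} (∧-trueʳ {p x} h)))))
      from : x == g y ≡ true → p x ∧ (y == f x) ≡ true
      from h = subst (λ z → p z ∧ (y == f z) ≡ true) (sym (==-sound {A = x} h))
                 (∧-true (qp y qy) (==-complete (sym (fg y qy))))
  ... | false = ∑-zero′ none S
    where
    none : ∀ x → when (p x) (when (y == f x) (φ x)) ≡ + 0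
    none x = trans (when-∧ (p x) _ _) (when-false _ (≢true⇒≡false λ h →
      false≢true (trans (sym qy) (subst (λ z → q z ≡ true)
                                        (sym (==-sound {A = y} (∧-trueʳ {p x} h))) (pq x (∧-trueˡ h))))))

-- Möbius functions on a family of subsets ordered by inclusion

module Incidence {n : ℕ} (P : Subset n → Bool) (m : Subset n → Subset n → ℤ) where

  open ≡-Reasoning

  between : Subset n → Subset n → Subset n → Bool
  between G H F = P F ∧ (subB G F ∧ subB F H)

  LeftMöbius : Set
  LeftMöbius = ∀ G H → P G ≡ true → P H ≡ true → subB G H ≡ true →
    ∑ (allSubsets n) (λ F → when (between G H F) (m G F)) ≡ when (G == H) (+ 1)

  rightSum : Subset n → Subset n → ℤ
  rightSum G H = ∑ (allSubsets n) (λ F → when (between G H F) (m F H))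

  between⁺ : ∀ G H F → P F ≡ true → subB G F ≡ true → subB F H ≡ true → between G H F ≡ true
  between⁺ G H F pF GF FH = ∧-true pF (∧-true GF FH)

  between⁻ : ∀ G H F → between G H F ≡ true → P F ≡ true × subB G F ≡ true × subB F H ≡ true
  between⁻ G H F h with P F | subB G F | h
  ... | true | true | FH = refl , refl , FH

  between-refl : ∀ G → P G ≡ true → between G G G ≡ true
  between-refl G pG = between⁺ G G G pG (subB-refl G) (subB-refl G)

  between-diag : ∀ {G} F → P G ≡ true → between G G F ≡ F == G
  between-diag {G} F pG = ≡true-ext
    (λ h → let _ , GF , FG = between⁻ G G F h in ==-complete (subB-antisym {A = F} FG GF))
    (λ h → subst (λ Z → between G G Z ≡ true) (sym (==-sound {A = F} h)) (between-refl G pG))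

  between-nested : ∀ G H K F → between G H K ∧ between G K F ≡ between G H F ∧ between F H K
  between-nested G H K F = ≡true-ext to from
    where
    to : between G H K ∧ between G K F ≡ true → between G H F ∧ between F H K ≡ true
    to h with between⁻ G H K (∧-trueˡ h) | between⁻ G K F (∧-trueʳ {between G H K} h)
    ... | pK , GK , KH | pF , GF , FK =
      ∧-true (between⁺ G H F pF GF (subB-trans {A = F} FK KH)) (between⁺ F H K pK FK KH)
    from : between G H F ∧ between F H K ≡ true → between G H K ∧ between G K F ≡ true
    from h with between⁻ G H F (∧-trueˡ h) | between⁻ F H K (∧-trueʳ {between G H F} h)
    ... | pF , GF , FH | pK , FK , KH =
      ∧-true (between⁺ G H K pK (subB-trans {A = G} GF FK) KH) (between⁺ G K F pF GF FK)

  module _ (left : LeftMöbius) where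

    m-diag : ∀ G → P G ≡ true → m G G ≡ + 1
    m-diag G pG = begin
      m G G
        ≡⟨ sym (∑-delta n G (m G)) ⟩
      ∑ (allSubsets n) (λ F → when (F == G) (m G F))
        ≡⟨ ∑-cong (λ F → cong (λ b → when b (m G F)) (sym (between-diag F pG))) (allSubsets n) ⟩
      ∑ (allSubsets n) (λ F → when (between G G F) (m G F))
        ≡⟨ left G G pG pG (subB-refl G) ⟩
      when (G == G) (+ 1)
        ≡⟨ when-true _ (==-refl G) ⟩
      + 1 ∎

    -- Σ_{G ⊆ F ⊆ K ⊆ H} m(G,F) m(K,H), evaluated once by the left and once by the right Möbius sums.
    twoSided : Subset n → Subset n → ℤ
    twoSided G H = ∑ S (λ F → when (between G H F) (m G F *ℤ rightSum F H))
      where S = allSubsets n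

    twoSided≡m : ∀ G H → P G ≡ true → subB G H ≡ true → twoSided G H ≡ m G H
    twoSided≡m G H pG GH = begin
      twoSided G H
        ≡⟨ ∑-cong expand S ⟩
      ∑ S (λ F → ∑ S (λ K → when (between G H F) (when (between F H K) (m G F *ℤ m K H))))
        ≡⟨ ∑-swap S S _ ⟩
      ∑ S (λ K → ∑ S (λ F → when (between G H F) (when (between F H K) (m G F *ℤ m K H))))
        ≡⟨ ∑-cong regroup S ⟩
      ∑ S (λ K → when (between G H K) (m K H *ℤ ∑ S (λ F → when (between G K F) (m G F))))
        ≡⟨ ∑-cong (λ K → when-cong (λ b → let pK , _ , _ = between⁻ G H K b in
                                      cong (m K H *ℤ_) (left G K pG pK (∧-trueˡ (∧-trueʳ {P K} b))))) S ⟩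
      ∑ S (λ K → when (between G H K) (m K H *ℤ when (G == K) (+ 1)))
        ≡⟨ ∑-cong collapse S ⟩
      ∑ S (λ K → when (G == K) (m K H))
        ≡⟨ ∑-delta′ n G (λ K → m K H) ⟩
      m G H ∎
      where
      S = allSubsets n
      expand : ∀ F → when (between G H F) (m G F *ℤ rightSum F H)
                   ≡ ∑ S (λ K → when (between G H F) (when (between F H K) (m G F *ℤ m K H)))
      expand F = begin
        when (between G H F) (m G F *ℤ rightSum F H)
          ≡⟨ cong (when (between G H F)) (sym (∑-*ˡ (m G F) _ S)) ⟩
        when (between G H F) (∑ S (λ K → m G F *ℤ when (between F H K) (m K H)))
          ≡⟨ when-∑ (between G H F) _ S ⟩
        ∑ S (λ K → when (between G H F) (m G F *ℤ when (between F H K) (m K H)))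
          ≡⟨ ∑-cong (λ K → cong (when (between G H F)) (when-*ˡ (between F H K) (m G F) (m K H))) S ⟩
        ∑ S (λ K → when (between G H F) (when (between F H K) (m G F *ℤ m K H))) ∎
      regroup : ∀ K → ∑ S (λ F → when (between G H F) (when (between F H K) (m G F *ℤ m K H)))
                    ≡ when (between G H K) (m K H *ℤ ∑ S (λ F → when (between G K F) (m G F)))
      regroup K = sym (begin
        when (between G H K) (m K H *ℤ ∑ S (λ F → when (between G K F) (m G F)))
          ≡⟨ cong (when (between G H K)) (sym (∑-*ˡ (m K H) _ S)) ⟩
        when (between G H K) (∑ S (λ F → m K H *ℤ when (between G K F) (m G F)))
          ≡⟨ when-∑ (between G H K) _ S ⟩
        ∑ S (λ F → when (between G H K) (m K H *ℤ when (between G K F) (m G F)))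
          ≡⟨ ∑-cong reorder S ⟩
        ∑ S (λ F → when (between G H F) (when (between F H K) (m G F *ℤ m K H))) ∎)
        where
        reorder : ∀ F → when (between G H K) (m K H *ℤ when (between G K F) (m G F))
                      ≡ when (between G H F) (when (between F H K) (m G F *ℤ m K H))
        reorder F = begin
          when (between G H K) (m K H *ℤ when (between G K F) (m G F))
            ≡⟨ cong (when (between G H K)) (when-*ˡ (between G K F) (m K H) (m G F)) ⟩
          when (between G H K) (when (between G K F) (m K H *ℤ m G F))
            ≡⟨ when-∧ (between G H K) (between G K F) _ ⟩
          when (between G H K ∧ between G K F) (m K H *ℤ m G F)
            ≡⟨ cong₂ when (between-nested G H K F) (ZP.*-comm (m K H) (m G F)) ⟩
          when (between G H F ∧ between F H K) (m G F *ℤ m K H)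
            ≡⟨ sym (when-∧ (between G H F) (between F H K) _) ⟩
          when (between G H F) (when (between F H K) (m G F *ℤ m K H)) ∎
      collapse : ∀ K → when (between G H K) (m K H *ℤ when (G == K) (+ 1)) ≡ when (G == K) (m K H)
      collapse K with G == K in GK
      ... | true  = trans (when-true _ (subst (λ Z → between G H Z ≡ true) (==-sound {A = G} GK)
                                          (between⁺ G H G pG (subB-refl G) GH)))
                          (ZP.*-identityʳ (m K H))
      ... | false = trans (cong (when (between G H K)) (ZP.*-zeroʳ (m K H))) (when-zero _)

    RightMöbiusAbove : Subset n → Subset n → Set
    RightMöbiusAbove G H = ∀ F → P F ≡ true → subB G F ≡ true → subB F H ≡ true → G == F ≡ false →
      rightSum F H ≡ when (F == H) (+ 1)

    twoSided≡rightSum : ∀ G H → P G ≡ true → P H ≡ true → subB G H ≡ true → RightMöbiusAbove G H →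
      twoSided G H ≡ rightSum G H +ℤ when (not (G == H)) (m G H)
    twoSided≡rightSum G H pG pH GH ih = begin
      twoSided G H
        ≡⟨ ∑-cong termwise S ⟩
      ∑ S (λ F → when (G == F) (rightSum G H) +ℤ when (not (G == F)) (when (F == H) (m G F)))
        ≡⟨ ∑-+ _ _ S ⟩
      ∑ S (λ F → when (G == F) (rightSum G H)) +ℤ ∑ S (λ F → when (not (G == F)) (when (F == H) (m G F)))
        ≡⟨ cong₂ _+ℤ_ (∑-delta′ n G (λ _ → rightSum G H)) offDiagonal ⟩
      rightSum G H +ℤ when (not (G == H)) (m G H) ∎
      where
      S = allSubsets n
      offDiagonal : ∑ S (λ F → when (not (G == F)) (when (F == H) (m G F))) ≡ when (not (G == H)) (m G H)
      offDiagonal = trans (∑-cong (λ F → when-comm (not (G == F)) (F == H) (m G F)) S)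
                          (∑-delta n H (λ F → when (not (G == F)) (m G F)))
      termwise : ∀ F → when (between G H F) (m G F *ℤ rightSum F H)
                     ≡ when (G == F) (rightSum G H) +ℤ when (not (G == F)) (when (F == H) (m G F))
      termwise F with G == F in GF
      ... | true with ==-sound {A = G} GF
      ...   | refl = begin
        when (between G H G) (m G G *ℤ rightSum G H)
          ≡⟨ when-true _ (between⁺ G H G pG (subB-refl G) GH) ⟩
        m G G *ℤ rightSum G H
          ≡⟨ cong (_*ℤ rightSum G H) (m-diag G pG) ⟩
        + 1 *ℤ rightSum G H
          ≡⟨ ZP.*-identityˡ _ ⟩
        rightSum G H
          ≡⟨ sym (ZP.+-identityʳ _) ⟩
        rightSum G H +ℤ + 0 ∎
      termwise F | false = trans (offDiagonalTerm (between G H F) refl) (sym (ZP.+-identityˡ _))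
        where
        offDiagonalTerm : ∀ b → between G H F ≡ b → when b (m G F *ℤ rightSum F H) ≡ when (F == H) (m G F)
        offDiagonalTerm true  b = let pF , GF′ , FH = between⁻ G H F b in begin
          m G F *ℤ rightSum F H           ≡⟨ cong (m G F *ℤ_) (ih F pF GF′ FH GF) ⟩
          m G F *ℤ when (F == H) (+ 1)    ≡⟨ when-*ˡ (F == H) (m G F) (+ 1) ⟩
          when (F == H) (m G F *ℤ + 1)    ≡⟨ cong (when (F == H)) (ZP.*-identityʳ (m G F)) ⟩
          when (F == H) (m G F)           ∎
        offDiagonalTerm false b = sym (when-false _ (≢true⇒≡false λ FH →
          false≢true (trans (sym b) (subst (λ Z → between G H Z ≡ true) (sym (==-sound {A = F} FH))
                                       (between⁺ G H H pH GH (subB-refl H))))))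

    rightSum-outside : ∀ G H → subB G H ≡ false → rightSum G H ≡ when (G == H) (+ 1)
    rightSum-outside G H GH =
      trans (∑-zero′ (λ F → when-false _ (notBetween F)) (allSubsets n)) (sym (when-false _ G≠H))
      where
      G≠H : G == H ≡ false
      G≠H = ≢true⇒≡false λ G=H →
        false≢true (trans (sym GH) (subst (λ Z → subB G Z ≡ true) (==-sound {A = G} G=H) (subB-refl G)))
      notBetween : ∀ F → between G H F ≡ false
      notBetween F = ≢true⇒≡false λ b → let _ , GF , FH = between⁻ G H F b in
        false≢true (trans (sym GH) (subB-trans {A = G} GF FH))

    rightSum-solve : ∀ G H → P G ≡ true → m G H ≡ rightSum G H +ℤ when (not (G == H)) (m G H) →
      rightSum G H ≡ when (G == H) (+ 1)
    rightSum-solve G H pG eq with G == H in GH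
    ... | false = identityˡ-unique (rightSum G H) (m G H) (sym eq)
    ... | true with ==-sound {A = G} GH
    ...   | refl = begin
      rightSum G G          ≡⟨ sym (ZP.+-identityʳ _) ⟩
      rightSum G G +ℤ + 0   ≡⟨ sym eq ⟩
      m G G                 ≡⟨ m-diag G pG ⟩
      + 1                   ∎

    rightMöbius-acc : ∀ G H → Acc _<_ (∣ H ∣ ∸ ∣ G ∣) → P G ≡ true → P H ≡ true →
      rightSum G H ≡ when (G == H) (+ 1)
    rightMöbius-acc G H (acc rec) pG pH with subB G H in GH
    ... | false = rightSum-outside G H GH
    ... | true  = rightSum-solve G H pG
                    (trans (sym (twoSided≡m G H pG GH)) (twoSided≡rightSum G H pG pH GH above))
      where
      above : RightMöbiusAbove G H
      above F pF GF FH G≠F = rightMöbius-acc F H (rec shorter) pF pH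
        where
        shorter : ∣ H ∣ ∸ ∣ F ∣ < ∣ H ∣ ∸ ∣ G ∣
        shorter = NP.∸-monoʳ-<
          (∣∣-mono-⊏ (subB-sound {A = G} {F} GF) (λ G≡F → false≢true (trans (sym G≠F) (==-complete G≡F))))
          (∣∣-mono-⊑ (subB-sound {A = F} {H} FH))

    rightMöbius : ∀ G H → P G ≡ true → P H ≡ true → rightSum G H ≡ when (G == H) (+ 1)
    rightMöbius G H = rightMöbius-acc G H (<-wellFounded _)

-- Flats and closure

all-by-recursion : ∀ {A : Set} (c : A → Bool) (h : List A → Bool) → h [] ≡ true →
  (∀ x xs → h (x ∷ xs) ≡ c x ∧ h xs) → ∀ xs → h xs ≡ all c xs
all-by-recursion c h h[] h∷ []       = h[]
all-by-recursion c h h[] h∷ (x ∷ xs) = trans (h∷ x xs) (cong (c x ∧_) (all-by-recursion c h h[] h∷ xs))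

all-tabulate⁻ : ∀ {A : Set} {k} (c : A → Bool) (f : Fin k → A) → all c (L.tabulate f) ≡ true → ∀ i → c (f i) ≡ true
all-tabulate⁻ c f p zero    = ∧-trueˡ p
all-tabulate⁻ c f p (suc i) = all-tabulate⁻ c (λ j → f (suc j)) (∧-trueʳ {c (f zero)} p) i

all-tabulate⁺ : ∀ {A : Set} {k} (c : A → Bool) (f : Fin k → A) → (∀ i → c (f i) ≡ true) → all c (L.tabulate f) ≡ true
all-tabulate⁺ {k = zero}  c f h = refl
all-tabulate⁺ {k = suc k} c f h = ∧-true (h zero) (all-tabulate⁺ c (λ j → f (suc j)) (λ i → h (suc i)))

disjointᵇ : ∀ {k} → Subset k → Subset k → Bool
disjointᵇ F G = allB (zipWith (λ f g → not (f ∧ g)) F G)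

disjointᵇ-sound : ∀ {k} (F G : Subset k) → disjointᵇ F G ≡ true → ∀ e → lookup F e ∧ lookup G e ≡ false
disjointᵇ-sound (f ∷ F) (g ∷ G) p zero    = head f g (∧-trueˡ p)
  where
  head : ∀ f g → not (f ∧ g) ≡ true → f ∧ g ≡ false
  head true  true  ()
  head true  false q = refl
  head false g     q = refl
disjointᵇ-sound (f ∷ F) (g ∷ G) p (suc e) = disjointᵇ-sound F G (∧-trueʳ {not (f ∧ g)} p) e

disjointᵇ-complete : ∀ {k} (F G : Subset k) → (∀ e → lookup F e ∧ lookup G e ≡ false) → disjointᵇ F G ≡ true
disjointᵇ-complete []      []      h = refl
disjointᵇ-complete (f ∷ F) (g ∷ G) h = ∧-true (cong not (h zero)) (disjointᵇ-complete F G (λ e → h (suc e)))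

⁅⁆-⊑ : ∀ {n} {A : Subset n} {x} → lookup A x ≡ true → ⁅ x ⁆ ⊑ A
⁅⁆-⊑ {A = A} {x} p = ⊑-pointwise λ e q → subst (λ z → lookup A z ≡ true) (lookup-⁅⁆⇒≡ x e q) p

∪-⁅⁆-absorb : ∀ {n} (A : Subset n) {x} → lookup A x ≡ true → A ∪ ⁅ x ⁆ ≡ A
∪-⁅⁆-absorb A p = ⊑-antisym (∪-⊑ (⊑-refl A) (⁅⁆-⊑ p)) (⊑-∪ˡ A _)

─-⊑ : ∀ {n} (E F : Subset n) → E ─ F ⊑ E
─-⊑ E F = ⊑-pointwise λ e p → ∧-trueˡ (trans (sym (lookup-─ E F e)) p)

∪-─-cancel : ∀ {n} {F E : Subset n} → F ⊑ E → F ∪ (E ─ F) ≡ E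
∪-─-cancel {F = F} {E} F⊑E = ⊑-antisym (∪-⊑ F⊑E (─-⊑ E F)) (⊑-pointwise at)
  where
  at : ∀ e → lookup E e ≡ true → lookup (F ∪ (E ─ F)) e ≡ true
  at e p with lookup F e in f
  ... | true  = ⊑-at (⊑-∪ˡ F (E ─ F)) e f
  ... | false = ⊑-at (⊑-∪ʳ F (E ─ F)) e (trans (lookup-─ E F e) (cong₂ (λ a b → a ∧ not b) p f))

∪-─-disjoint : ∀ {n} (F G : Subset n) → (∀ e → lookup F e ∧ lookup G e ≡ false) → (F ∪ G) ─ F ≡ G
∪-─-disjoint F G disjoint = Subset-ext λ e →
  trans (lookup-─ (F ∪ G) F e)
        (trans (cong (λ z → z ∧ not (lookup F e)) (lookup-∪ F G e)) (bits (lookup F e) (lookup G e) (disjoint e)))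
  where
  bits : ∀ f g → f ∧ g ≡ false → (f ∨ g) ∧ not f ≡ g
  bits true  true  ()
  bits true  false _ = refl
  bits false g     _ = BP.∧-identityʳ g

p─p≡⊥ : ∀ {n} (A : Subset n) → A ─ A ≡ ⊥
p─p≡⊥ []          = refl
p─p≡⊥ (true ∷ A)  = cong (false ∷_) (p─p≡⊥ A)
p─p≡⊥ (false ∷ A) = cong (false ∷_) (p─p≡⊥ A)

subB-─ : ∀ {n} {G H : Subset n} (K : Subset n) → G ⊑ H → subB (K ─ G) (H ─ G) ≡ subB K H
subB-─ {G = G} {H} K G⊑H = ≡true-ext
  (λ p → subB-complete {A = K} (⊑-pointwise (to (subB-sound p))))
  (λ p → subB-complete {A = K ─ G} (⊑-pointwise (from (subB-sound p))))
  where
  to : K ─ G ⊑ H ─ G → ∀ e → lookup K e ≡ true → lookup H e ≡ true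
  to h e p with lookup G e in g
  ... | true  = ⊑-at G⊑H e g
  ... | false = ⊑-at (─-⊑ H G) e (⊑-at h e (trans (lookup-─ K G e) (cong₂ (λ a b → a ∧ not b) p g)))
  from : K ⊑ H → ∀ e → lookup (K ─ G) e ≡ true → lookup (H ─ G) e ≡ true
  from h e p = trans (lookup-─ H G e) (∧-true (⊑-at h e (∧-trueˡ q)) (∧-trueʳ {lookup K e} q))
    where q = trans (sym (lookup-─ K G e)) p

∸-cancelʳ-≡ : ∀ {a b c} → c ≤ a → c ≤ b → a ∸ c ≡ b ∸ c → a ≡ b
∸-cancelʳ-≡ {a} {b} {c} c≤a c≤b eq = begin
  a           ≡⟨ sym (NP.m∸n+n≡m c≤a) ⟩
  a ∸ c +ℕ c  ≡⟨ cong (_+ℕ c) eq ⟩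
  b ∸ c +ℕ c  ≡⟨ NP.m∸n+n≡m c≤b ⟩
  b           ∎
  where open ≡-Reasoning

module Flats {n : ℕ} (M : Matroid n) where

  rk-mono-⊑ : ∀ {A B} → A ⊑ B → rk M A ≤ rk M B
  rk-mono-⊑ h = rk-mono M (⊑⇒⊆ h)

  rk≤rkM : ∀ A → rk M A ≤ rkM M
  rk≤rkM A = rk-mono-⊑ (⊑-pointwise λ e _ → lookup-⊤ e)

  Closed : Subset n → Set
  Closed F = ∀ e → rk M (F ∪ ⁅ e ⁆) ≡ rk M F → lookup F e ≡ true

  flatAt : Subset n → Fin n → Bool
  flatAt F e = if (rk M (F ∪ ⁅ e ⁆) ==ℕ rk M F) then lookup F e else not (lookup F e)

  -- isFlat recurses through a helper local to Defs; unification recovers it as flatLoop.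
  mutual
    flatLoop : Subset n → List (Fin n) → Bool
    flatLoop = _

    isFlat≡all : ∀ F → isFlat M F ≡ all (flatAt F) (allFin n)
    isFlat≡all F with allFin n
    ... | es = all-by-recursion (flatAt F) (flatLoop F) refl (λ _ _ → refl) es

  isFlat⇒Closed : ∀ F → isFlat M F ≡ true → Closed F
  isFlat⇒Closed F p e q = trans (sym (if-true (==ℕ-complete q)))
                                (all-tabulate⁻ (flatAt F) (λ x → x) (trans (sym (isFlat≡all F)) p) e)

  Closed⇒isFlat : ∀ F → Closed F → isFlat M F ≡ true
  Closed⇒isFlat F h = trans (isFlat≡all F) (all-tabulate⁺ (flatAt F) (λ x → x) flat)
    where
    flat : ∀ e → flatAt F e ≡ true
    flat e with lookup F e in eF
    ... | true  = if-true (==ℕ-complete (cong (rk M) (∪-⁅⁆-absorb F eF)))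
    ... | false = if-false (==ℕ-false (λ r → false≢true (trans (sym eF) (h e r))))

  rk-∪-absorb : ∀ X Y Z → Z ⊑ X ∩ Y → rk M Y ≡ rk M Z → rk M (X ∪ Y) ≤ rk M X
  rk-∪-absorb X Y Z Z⊑X∩Y rkY = NP.+-cancelʳ-≤ (rk M (X ∩ Y)) (rk M (X ∪ Y)) (rk M X) (begin
    rk M (X ∪ Y) +ℕ rk M (X ∩ Y)  ≤⟨ rk-sub M X Y ⟩
    rk M X +ℕ rk M Y              ≡⟨ cong (rk M X +ℕ_) rkY ⟩
    rk M X +ℕ rk M Z              ≤⟨ NP.+-monoʳ-≤ (rk M X) (rk-mono-⊑ Z⊑X∩Y) ⟩
    rk M X +ℕ rk M (X ∩ Y)        ∎)
    where open NP.≤-Reasoning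

  cl : Subset n → Subset n
  cl A = tabulate (λ e → rk M (A ∪ ⁅ e ⁆) ==ℕ rk M A)

  lookup-cl : ∀ A e → lookup (cl A) e ≡ (rk M (A ∪ ⁅ e ⁆) ==ℕ rk M A)
  lookup-cl A e = VP.lookup∘tabulate _ e

  ∈-cl⇒rk : ∀ A e → lookup (cl A) e ≡ true → rk M (A ∪ ⁅ e ⁆) ≡ rk M A
  ∈-cl⇒rk A e p = ==ℕ-sound (trans (sym (lookup-cl A e)) p)

  ⊑-cl : ∀ A → A ⊑ cl A
  ⊑-cl A = ⊑-pointwise λ e p → trans (lookup-cl A e) (==ℕ-complete (cong (rk M) (∪-⁅⁆-absorb A p)))

  rk-∪-cl-acc : ∀ A T → Acc _<_ ∣ T ∣ → T ⊑ cl A → rk M (A ∪ T) ≡ rk M A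
  rk-∪-cl-acc A T (acc rec) T⊑clA with SP.nonempty? T
  ... | no ¬nonempty rewrite SP.Empty-unique ¬nonempty = cong (rk M) (SP.∪-identityʳ A)
  ... | yes (x , x∈T) = NP.≤-antisym (begin
    rk M (A ∪ T)   ≤⟨ rk-mono-⊑ (∪-⊑ (⊑-trans (⊑-∪ˡ A T′) (⊑-∪ˡ X Y)) T⊑X∪Y) ⟩
    rk M (X ∪ Y)   ≤⟨ rk-∪-absorb X Y A (⊑-∩ (⊑-∪ˡ A T′) (⊑-∪ˡ A ⁅ x ⁆)) (∈-cl⇒rk A x (⊑-at T⊑clA x (VP.[]=⇒lookup x∈T))) ⟩
    rk M X         ≡⟨ rk-∪-cl-acc A T′ (rec (SP.x∈p⇒∣p-x∣<∣p∣ x∈T)) (⊑-trans T′⊑T T⊑clA) ⟩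
    rk M A         ∎) (rk-mono-⊑ (⊑-∪ˡ A T))
    where
    open NP.≤-Reasoning
    T′ = T - x
    X = A ∪ T′
    Y = A ∪ ⁅ x ⁆
    T′⊑T : T′ ⊑ T
    T′⊑T = ⊑-pointwise λ e p → ∧-trueˡ (trans (sym (lookup-─ T ⁅ x ⁆ e)) p)
    T⊑X∪Y : T ⊑ X ∪ Y
    T⊑X∪Y = ⊑-pointwise at
      where
      at : ∀ e → lookup T e ≡ true → lookup (X ∪ Y) e ≡ true
      at e p with x ≟ᶠ e
      ... | yes refl = ⊑-at (⊑-trans (⊑-∪ʳ A ⁅ x ⁆) (⊑-∪ʳ X Y)) x (lookup-⁅⁆-≡ x)
      ... | no  x≢e  = ⊑-at (⊑-trans (⊑-∪ʳ A T′) (⊑-∪ˡ X Y)) e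
        (trans (lookup-─ T ⁅ x ⁆ e) (cong₂ (λ a b → a ∧ not b) p (lookup-⁅⁆-≢ x e x≢e)))

  rk-cl : ∀ A → rk M (cl A) ≡ rk M A
  rk-cl A = NP.≤-antisym
    (NP.≤-trans (rk-mono-⊑ (⊑-∪ʳ A (cl A))) (NP.≤-reflexive (rk-∪-cl-acc A (cl A) (<-wellFounded _) (⊑-refl (cl A)))))
    (rk-mono-⊑ (⊑-cl A))

  cl-Closed : ∀ A → Closed (cl A)
  cl-Closed A e rk-eq = trans (lookup-cl A e) (==ℕ-complete (NP.≤-antisym
    (NP.≤-trans (rk-mono-⊑ (∪-⊑ (⊑-trans (⊑-cl A) (⊑-∪ˡ (cl A) ⁅ e ⁆)) (⊑-∪ʳ (cl A) ⁅ e ⁆)))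
                (NP.≤-reflexive (trans rk-eq (rk-cl A))))
    (rk-mono-⊑ (⊑-∪ˡ A ⁅ e ⁆))))

  cl-isFlat : ∀ A → isFlat M (cl A) ≡ true
  cl-isFlat A = Closed⇒isFlat (cl A) (cl-Closed A)

  cl-least : ∀ A F → Closed F → A ⊑ F → cl A ⊑ F
  cl-least A F F-closed A⊑F = ⊑-pointwise at
    where
    at : ∀ e → lookup (cl A) e ≡ true → lookup F e ≡ true
    at e e∈clA = F-closed e (NP.≤-antisym
      (NP.≤-trans (rk-mono-⊑ (∪-⊑ (⊑-∪ˡ F Y) (⊑-trans (⊑-∪ʳ A ⁅ e ⁆) (⊑-∪ʳ F Y))))
                  (rk-∪-absorb F Y A (⊑-∩ A⊑F (⊑-∪ˡ A ⁅ e ⁆)) (∈-cl⇒rk A e e∈clA)))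
      (rk-mono-⊑ (⊑-∪ˡ F ⁅ e ⁆)))
      where Y = A ∪ ⁅ e ⁆

  contractFlatAt : Subset n → Subset n → Fin n → Bool
  contractFlatAt F G e = if lookup F e then true
    else (if (rkC M F (G ∪ ⁅ e ⁆) ==ℕ rkC M F G) then lookup G e else not (lookup G e))

  mutual
    contractFlatLoop : Subset n → Subset n → List (Fin n) → Bool
    contractFlatLoop = _

    isFlatC≡all : ∀ F G → isFlatC M F G ≡ disjointᵇ F G ∧ all (contractFlatAt F G) (allFin n)
    isFlatC≡all F G with allFin n
    ... | es = cong (disjointᵇ F G ∧_)
                    (all-by-recursion (contractFlatAt F G) (contractFlatLoop F G) refl (λ _ _ → refl) es)

  isFlatC-disjoint : ∀ F G → isFlatC M F G ≡ true → ∀ e → lookup F e ∧ lookup G e ≡ false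
  isFlatC-disjoint F G p = disjointᵇ-sound F G (∧-trueˡ (trans (sym (isFlatC≡all F G)) p))

  isFlatC-at : ∀ F G → isFlatC M F G ≡ true → ∀ e → contractFlatAt F G e ≡ true
  isFlatC-at F G p = all-tabulate⁻ (contractFlatAt F G) (λ x → x)
                       (∧-trueʳ {disjointᵇ F G} (trans (sym (isFlatC≡all F G)) p))

  isFlatC⇒Closed-∪ : ∀ F G → isFlatC M F G ≡ true → Closed (F ∪ G)
  isFlatC⇒Closed-∪ F G p e rk-eq = trans (lookup-∪ F G e) (inG (lookup F e) refl)
    where
    open ≡-Reasoning
    rkC-eq : rkC M F (G ∪ ⁅ e ⁆) ≡ rkC M F G
    rkC-eq = begin
      rk M ((G ∪ ⁅ e ⁆) ∪ F) ∸ rk M F   ≡⟨ cong (λ Z → rk M Z ∸ rk M F) (SP.∪-comm (G ∪ ⁅ e ⁆) F) ⟩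
      rk M (F ∪ (G ∪ ⁅ e ⁆)) ∸ rk M F   ≡⟨ cong (λ Z → rk M Z ∸ rk M F) (sym (SP.∪-assoc F G ⁅ e ⁆)) ⟩
      rk M ((F ∪ G) ∪ ⁅ e ⁆) ∸ rk M F   ≡⟨ cong (_∸ rk M F) rk-eq ⟩
      rk M (F ∪ G) ∸ rk M F             ≡⟨ cong (λ Z → rk M Z ∸ rk M F) (SP.∪-comm F G) ⟩
      rk M (G ∪ F) ∸ rk M F             ∎
    inG : ∀ b → lookup F e ≡ b → b ∨ lookup G e ≡ true
    inG true  _  = refl
    inG false eF = begin
      lookup G e                         ≡⟨ sym (if-true (==ℕ-complete rkC-eq)) ⟩
      (if (rkC M F (G ∪ ⁅ e ⁆) ==ℕ rkC M F G) then lookup G e else not (lookup G e))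
                                         ≡⟨ sym (if-false eF) ⟩
      contractFlatAt F G e               ≡⟨ isFlatC-at F G p e ⟩
      true                               ∎

  Closed⇒isFlatC-─ : ∀ F E → Closed E → F ⊑ E → isFlatC M F (E ─ F) ≡ true
  Closed⇒isFlatC-─ F E E-closed F⊑E =
    trans (isFlatC≡all F D) (∧-true disjoint (all-tabulate⁺ (contractFlatAt F D) (λ x → x) at))
    where
    D = E ─ F
    D∪F : D ∪ F ≡ E
    D∪F = trans (SP.∪-comm D F) (∪-─-cancel F⊑E)
    D∪e∪F : ∀ {e} → (D ∪ ⁅ e ⁆) ∪ F ≡ E ∪ ⁅ e ⁆
    D∪e∪F {e} = begin
      (D ∪ ⁅ e ⁆) ∪ F  ≡⟨ SP.∪-assoc D ⁅ e ⁆ F ⟩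
      D ∪ (⁅ e ⁆ ∪ F)  ≡⟨ cong (D ∪_) (SP.∪-comm ⁅ e ⁆ F) ⟩
      D ∪ (F ∪ ⁅ e ⁆)  ≡⟨ sym (SP.∪-assoc D F ⁅ e ⁆) ⟩
      (D ∪ F) ∪ ⁅ e ⁆  ≡⟨ cong (_∪ ⁅ e ⁆) D∪F ⟩
      E ∪ ⁅ e ⁆        ∎
      where open ≡-Reasoning
    disjoint : disjointᵇ F D ≡ true
    disjoint = disjointᵇ-complete F D λ e →
      trans (cong (lookup F e ∧_) (lookup-─ E F e)) (bits (lookup F e) (lookup E e))
      where
      bits : ∀ f x → f ∧ (x ∧ not f) ≡ false
      bits true  x = BP.∧-zeroʳ x
      bits false x = refl
    at : ∀ e → contractFlatAt F D e ≡ true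
    at e with lookup F e in eF
    ... | true  = refl
    ... | false with lookup E e in eE
    ...   | true  = trans (if-true (==ℕ-complete (cong (λ Z → rk M Z ∸ rk M F)
                            (trans D∪e∪F (trans (∪-⁅⁆-absorb E eE) (sym D∪F))))))
                          (trans (lookup-─ E F e) (cong₂ (λ a b → a ∧ not b) eE eF))
    ...   | false = trans (if-false (==ℕ-false λ rkC-eq → false≢true (trans (sym eE) (E-closed e
                            (∸-cancelʳ-≡ (rk-mono-⊑ (⊑-trans F⊑E (⊑-∪ˡ E ⁅ e ⁆))) (rk-mono-⊑ F⊑E)
                              (trans (cong (λ Z → rk M Z ∸ rk M F) (sym D∪e∪F))
                                (trans rkC-eq (cong (λ Z → rk M Z ∸ rk M F) D∪F))))))))
                          (cong not (trans (lookup-─ E F e) (cong₂ (λ a b → a ∧ not b) eE eF)))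

  ∑-flatsC : ∀ F (φ : Subset n → ℤ) →
    ∑ (allSubsets n) (λ G → when (isFlatC M F G) (φ G))
      ≡ ∑ (allSubsets n) (λ E → when (isFlat M E ∧ subB F E) (φ (E ─ F)))
  ∑-flatsC F φ = ∑-reindex n (isFlatC M F) (λ E → isFlat M E ∧ subB F E) (F ∪_) (_─ F) φ
    (λ G p → ∧-true (Closed⇒isFlat (F ∪ G) (isFlatC⇒Closed-∪ F G p)) (subB-complete (⊑-∪ˡ F G)))
    (λ E q → Closed⇒isFlatC-─ F E (isFlat⇒Closed E (∧-trueˡ q)) (subB-sound (∧-trueʳ {isFlat M E} q)))
    (λ G p → ∪-─-disjoint F G (isFlatC-disjoint F G p))
    (λ E q → ∪-─-cancel (subB-sound (∧-trueʳ {isFlat M E} q)))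

-- μ F ⊥ is the Möbius function of 𝓕(M/F) from its bottom; transported along G ↦ F ∪ G it becomes
-- the Möbius function of 𝓕(M) from F.
module FlatMöbius {n : ℕ} (M : Matroid n) (μ : Subset n → Subset n → Subset n → ℤ) (isMöbius : IsMobius M μ) where
  open Flats M
  open Incidence (isFlat M) (λ F H → μ F ⊥ (H ─ F))
  open ≡-Reasoning

  μᶠ : Subset n → Subset n → ℤ
  μᶠ F H = μ F ⊥ (H ─ F)

  ∑-μ-flatsC : ∀ F (c : Subset n → ℤ) →
    ∑ (flatsC M F) (λ G → μ F ⊥ G *ℤ c (F ∪ G))
      ≡ ∑ (allSubsets n) (λ H → when (isFlat M H ∧ subB F H) (μᶠ F H *ℤ c H))
  ∑-μ-flatsC F c = begin
    ∑ (flatsC M F) (λ G → μ F ⊥ G *ℤ c (F ∪ G))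
      ≡⟨ ∑-filter (isFlatC M F) _ (allSubsets n) ⟩
    ∑ (allSubsets n) (λ G → when (isFlatC M F G) (μ F ⊥ G *ℤ c (F ∪ G)))
      ≡⟨ ∑-flatsC F _ ⟩
    ∑ (allSubsets n) (λ H → when (isFlat M H ∧ subB F H) (μᶠ F H *ℤ c (F ∪ (H ─ F))))
      ≡⟨ ∑-cong (λ H → when-cong λ q →
                  cong (λ Z → μᶠ F H *ℤ c Z) (∪-─-cancel (subB-sound (∧-trueʳ {isFlat M H} q))))
                (allSubsets n) ⟩
    ∑ (allSubsets n) (λ H → when (isFlat M H ∧ subB F H) (μᶠ F H *ℤ c H)) ∎

  ⊥==─ : ∀ {G H : Subset n} → G ⊑ H → ⊥ == (H ─ G) ≡ G == H
  ⊥==─ {G} {H} G⊑H = ≡true-ext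
    (λ p → ==-complete (⊑-antisym G⊑H (⊑-pointwise (H⊑G (==-sound {A = ⊥} p)))))
    (λ p → ==-complete (trans (sym (p─p≡⊥ G)) (cong (_─ G) (==-sound {A = G} p))))
    where
    H⊑G : ⊥ ≡ H ─ G → ∀ e → lookup H e ≡ true → lookup G e ≡ true
    H⊑G eq e p with lookup G e in g
    ... | true  = refl
    ... | false = ⊥-elim (false≢true (begin
      false                         ≡⟨ sym (lookup-⊥ e) ⟩
      lookup ⊥ e                    ≡⟨ cong (λ Z → lookup Z e) eq ⟩
      lookup (H ─ G) e              ≡⟨ lookup-─ H G e ⟩
      lookup H e ∧ not (lookup G e) ≡⟨ cong₂ (λ a b → a ∧ not b) p g ⟩
      true                          ∎))

  μᶠ-leftMöbius : LeftMöbius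
  μᶠ-leftMöbius G H flatG flatH G⊆H = begin
    ∑ S (λ K → when (between G H K) (μᶠ G K))
      ≡⟨ ∑-cong (λ K → regroup K) S ⟩
    ∑ S (λ K → when (isFlat M K ∧ subB G K) (when (subB (K ─ G) D) (μᶠ G K)))
      ≡⟨ sym (∑-flatsC G _) ⟩
    ∑ S (λ K′ → when (isFlatC M G K′) (when (subB K′ D) (μ G ⊥ K′)))
      ≡⟨ ∑-cong (λ K′ → cong (λ b → when (isFlatC M G K′) (when (b ∧ subB K′ D) (μ G ⊥ K′)))
                              (sym (subB-⊥ K′))) S ⟩
    ∑ S (λ K′ → when (isFlatC M G K′) (when (subB ⊥ K′ ∧ subB K′ D) (μ G ⊥ K′)))
      ≡⟨ sym (∑-filter (isFlatC M G) _ S) ⟩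
    ∑ (flatsC M G) (λ K′ → when (subB ⊥ K′ ∧ subB K′ D) (μ G ⊥ K′))
      ≡⟨ sym (∑-filter (λ K′ → subB ⊥ K′ ∧ subB K′ D) (μ G ⊥) (flatsC M G)) ⟩
    ∑ (filter (λ K′ → (subB ⊥ K′ ∧ subB K′ D) B.≟ true) (flatsC M G)) (μ G ⊥)
      ≡⟨ proj₁ (isMöbius G flatG ⊥ D ⊥-flatC D-flatC) (subB-⊥ D) ⟩
    when (eqB ⊥ D) (+ 1)
      ≡⟨ cong (λ b → when b (+ 1)) (trans (eqB≡== ⊥ D) (⊥==─ G⊑H)) ⟩
    when (G == H) (+ 1) ∎
    where
    S = allSubsets n
    D = H ─ G
    G⊑H = subB-sound G⊆H
    ⊥-flatC : isFlatC M G ⊥ ≡ true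
    ⊥-flatC = subst (λ Z → isFlatC M G Z ≡ true) (p─p≡⊥ G)
                (Closed⇒isFlatC-─ G G (isFlat⇒Closed G flatG) (⊑-refl G))
    D-flatC : isFlatC M G D ≡ true
    D-flatC = Closed⇒isFlatC-─ G H (isFlat⇒Closed H flatH) G⊑H
    regroup : ∀ K → when (between G H K) (μᶠ G K)
                  ≡ when (isFlat M K ∧ subB G K) (when (subB (K ─ G) D) (μᶠ G K))
    regroup K = begin
      when (isFlat M K ∧ (subB G K ∧ subB K H)) (μᶠ G K)
        ≡⟨ cong (λ b → when b (μᶠ G K)) (sym (BP.∧-assoc (isFlat M K) (subB G K) (subB K H))) ⟩
      when ((isFlat M K ∧ subB G K) ∧ subB K H) (μᶠ G K)
        ≡⟨ sym (when-∧ (isFlat M K ∧ subB G K) (subB K H) _) ⟩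
      when (isFlat M K ∧ subB G K) (when (subB K H) (μᶠ G K))
        ≡⟨ cong (λ b → when (isFlat M K ∧ subB G K) (when b (μᶠ G K))) (sym (subB-─ K G⊑H)) ⟩
      when (isFlat M K ∧ subB G K) (when (subB (K ─ G) D) (μᶠ G K)) ∎

  ∑-flats-above : ∀ A (c : Subset n → ℤ) →
    ∑ (allSubsets n) (λ F → when (isFlat M F ∧ subB A F) (∑ (flatsC M F) (λ G → μ F ⊥ G *ℤ c (F ∪ G))))
      ≡ c (cl A)
  ∑-flats-above A c = begin
    ∑ S (λ F → when (isFlat M F ∧ subB A F) (∑ (flatsC M F) (λ G → μ F ⊥ G *ℤ c (F ∪ G))))
      ≡⟨ ∑-cong (λ F → trans (cong (when (isFlat M F ∧ subB A F)) (∑-μ-flatsC F c)) (when-∑ _ _ S)) S ⟩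
    ∑ S (λ F → ∑ S (λ H → when (isFlat M F ∧ subB A F) (when (isFlat M H ∧ subB F H) (μᶠ F H *ℤ c H))))
      ≡⟨ ∑-swap S S _ ⟩
    ∑ S (λ H → ∑ S (λ F → when (isFlat M F ∧ subB A F) (when (isFlat M H ∧ subB F H) (μᶠ F H *ℤ c H))))
      ≡⟨ ∑-cong (λ H → sym (factor H)) S ⟩
    ∑ S (λ H → when (isFlat M H) (c H *ℤ rightSum (cl A) H))
      ≡⟨ ∑-cong (λ H → when-cong λ flatH →
                  cong (c H *ℤ_) (rightMöbius μᶠ-leftMöbius (cl A) H (cl-isFlat A) flatH)) S ⟩
    ∑ S (λ H → when (isFlat M H) (c H *ℤ when (cl A == H) (+ 1)))
      ≡⟨ ∑-cong diagonal S ⟩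
    ∑ S (λ H → when (cl A == H) (c H))
      ≡⟨ ∑-delta′ n (cl A) c ⟩
    c (cl A) ∎
    where
    S = allSubsets n
    conditions : ∀ F H → isFlat M H ∧ between (cl A) H F ≡ (isFlat M F ∧ subB A F) ∧ (isFlat M H ∧ subB F H)
    conditions F H = ≡true-ext to from
      where
      to : isFlat M H ∧ between (cl A) H F ≡ true → (isFlat M F ∧ subB A F) ∧ (isFlat M H ∧ subB F H) ≡ true
      to h with between⁻ (cl A) H F (∧-trueʳ {isFlat M H} h)
      ... | flatF , clA⊆F , F⊆H =
        ∧-true (∧-true flatF (subB-complete (⊑-trans (⊑-cl A) (subB-sound clA⊆F)))) (∧-true (∧-trueˡ h) F⊆H)
      from : (isFlat M F ∧ subB A F) ∧ (isFlat M H ∧ subB F H) ≡ true → isFlat M H ∧ between (cl A) H F ≡ true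
      from h with ∧-trueˡ h | ∧-trueʳ {isFlat M F ∧ subB A F} h
      ... | AF | FH = ∧-true {isFlat M H} (∧-trueˡ FH) (between⁺ (cl A) H F (∧-trueˡ AF)
        (subB-complete (cl-least A F (isFlat⇒Closed F (∧-trueˡ AF)) (subB-sound (∧-trueʳ {isFlat M F} AF))))
        (∧-trueʳ {isFlat M H} FH))
    factor : ∀ H → when (isFlat M H) (c H *ℤ rightSum (cl A) H)
                 ≡ ∑ S (λ F → when (isFlat M F ∧ subB A F) (when (isFlat M H ∧ subB F H) (μᶠ F H *ℤ c H)))
    factor H = begin
      when (isFlat M H) (c H *ℤ rightSum (cl A) H)
        ≡⟨ cong (when (isFlat M H)) (sym (∑-*ˡ (c H) _ S)) ⟩
      when (isFlat M H) (∑ S (λ F → c H *ℤ when (between (cl A) H F) (μᶠ F H)))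
        ≡⟨ when-∑ _ _ S ⟩
      ∑ S (λ F → when (isFlat M H) (c H *ℤ when (between (cl A) H F) (μᶠ F H)))
        ≡⟨ ∑-cong termwise S ⟩
      ∑ S (λ F → when (isFlat M F ∧ subB A F) (when (isFlat M H ∧ subB F H) (μᶠ F H *ℤ c H))) ∎
      where
      termwise : ∀ F → when (isFlat M H) (c H *ℤ when (between (cl A) H F) (μᶠ F H))
                     ≡ when (isFlat M F ∧ subB A F) (when (isFlat M H ∧ subB F H) (μᶠ F H *ℤ c H))
      termwise F = begin
        when (isFlat M H) (c H *ℤ when (between (cl A) H F) (μᶠ F H))
          ≡⟨ cong (when (isFlat M H)) (when-*ˡ _ (c H) (μᶠ F H)) ⟩
        when (isFlat M H) (when (between (cl A) H F) (c H *ℤ μᶠ F H))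
          ≡⟨ when-∧ (isFlat M H) _ _ ⟩
        when (isFlat M H ∧ between (cl A) H F) (c H *ℤ μᶠ F H)
          ≡⟨ cong₂ when (conditions F H) (ZP.*-comm (c H) (μᶠ F H)) ⟩
        when ((isFlat M F ∧ subB A F) ∧ (isFlat M H ∧ subB F H)) (μᶠ F H *ℤ c H)
          ≡⟨ sym (when-∧ (isFlat M F ∧ subB A F) _ _) ⟩
        when (isFlat M F ∧ subB A F) (when (isFlat M H ∧ subB F H) (μᶠ F H *ℤ c H)) ∎
    diagonal : ∀ H → when (isFlat M H) (c H *ℤ when (cl A == H) (+ 1)) ≡ when (cl A == H) (c H)
    diagonal H with cl A == H in clA=H
    ... | true  = trans (when-true _ (subst (λ Z → isFlat M Z ≡ true) (==-sound {A = cl A} clA=H) (cl-isFlat A)))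
                        (ZP.*-identityʳ (c H))
    ... | false = trans (cong (when (isFlat M H)) (ZP.*-zeroʳ (c H))) (when-zero _)

-- Coefficients of the Tutte polynomial

coeffˣ : PolyX → ℕ → ℤ
coeffˣ = PX.coeffP

coeffˣʸ : PolyXY → ℕ → ℕ → ℤ
coeffˣʸ P i j = coeffˣ (PXY.coeffP P j) i

coeffˣ-addP : ∀ p q i → coeffˣ (PX.addP p q) i ≡ coeffˣ p i +ℤ coeffˣ q i
coeffˣ-addP []      q       i       = sym (ZP.+-identityˡ _)
coeffˣ-addP (a ∷ p) []      i       = sym (ZP.+-identityʳ _)
coeffˣ-addP (a ∷ p) (b ∷ q) zero    = refl
coeffˣ-addP (a ∷ p) (b ∷ q) (suc i) = coeffˣ-addP p q i

coeffˣ-scale : ∀ a q i → coeffˣ (map (a *ℤ_) q) i ≡ a *ℤ coeffˣ q i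
coeffˣ-scale a []      i       = sym (ZP.*-zeroʳ a)
coeffˣ-scale a (x ∷ q) zero    = refl
coeffˣ-scale a (x ∷ q) (suc i) = coeffˣ-scale a q i

coeffˣ-mulP-zero : ∀ a p q → coeffˣ (PX.mulP (a ∷ p) q) 0 ≡ a *ℤ coeffˣ q 0
coeffˣ-mulP-zero a p q =
  trans (coeffˣ-addP (map (a *ℤ_) q) (+ 0 ∷ PX.mulP p q) 0)
        (trans (cong (_+ℤ + 0) (coeffˣ-scale a q 0)) (ZP.+-identityʳ _))

coeffˣ-mulP-suc : ∀ a p q i →
  coeffˣ (PX.mulP (a ∷ p) q) (suc i) ≡ a *ℤ coeffˣ q (suc i) +ℤ coeffˣ (PX.mulP p q) i
coeffˣ-mulP-suc a p q i =
  trans (coeffˣ-addP (map (a *ℤ_) q) (+ 0 ∷ PX.mulP p q) (suc i))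
        (cong (_+ℤ coeffˣ (PX.mulP p q) i) (coeffˣ-scale a q (suc i)))

coeffˣ-mulP-constantˡ : ∀ a q i → coeffˣ (PX.mulP (a ∷ []) q) i ≡ a *ℤ coeffˣ q i
coeffˣ-mulP-constantˡ a q zero    = coeffˣ-mulP-zero a [] q
coeffˣ-mulP-constantˡ a q (suc i) = trans (coeffˣ-mulP-suc a [] q i) (ZP.+-identityʳ _)

coeffˣ-mulP-constantʳ : ∀ p q → (∀ k → coeffˣ q (suc k) ≡ + 0) →
  ∀ i → coeffˣ (PX.mulP p q) i ≡ coeffˣ p i *ℤ coeffˣ q 0
coeffˣ-mulP-constantʳ []      q h i       = sym (ZP.*-zeroˡ (coeffˣ q 0))
coeffˣ-mulP-constantʳ (a ∷ p) q h zero    = coeffˣ-mulP-zero a p q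
coeffˣ-mulP-constantʳ (a ∷ p) q h (suc i) = begin
  coeffˣ (PX.mulP (a ∷ p) q) (suc i)               ≡⟨ coeffˣ-mulP-suc a p q i ⟩
  a *ℤ coeffˣ q (suc i) +ℤ coeffˣ (PX.mulP p q) i  ≡⟨ cong₂ _+ℤ_ (trans (cong (a *ℤ_) (h i)) (ZP.*-zeroʳ a))
                                                                (coeffˣ-mulP-constantʳ p q h i) ⟩
  + 0 +ℤ coeffˣ p i *ℤ coeffˣ q 0                  ≡⟨ ZP.+-identityˡ _ ⟩
  coeffˣ p i *ℤ coeffˣ q 0                         ∎
  where open ≡-Reasoning

coeffˣ-mulP-[] : ∀ p i → coeffˣ (PX.mulP p []) i ≡ + 0
coeffˣ-mulP-[] p i = trans (coeffˣ-mulP-constantʳ p [] (λ k → refl) i) (ZP.*-zeroʳ (coeffˣ p i))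

altBinom : ℕ → ℕ → ℤ
altBinom a i = sgn (a +ℕ i) *ℤ binomℤ a i

altBinom-zero-suc : ∀ i → altBinom 0 (suc i) ≡ + 0
altBinom-zero-suc i = ZP.*-zeroʳ (sgn (suc i))

altBinom-suc-zero : ∀ a → altBinom (suc a) 0 ≡ - + 1 *ℤ altBinom a 0
altBinom-suc-zero a = ZP.*-assoc (- + 1) (sgn (a +ℕ 0)) (+ 1)

altBinom-suc-suc : ∀ a i → altBinom (suc a) (suc i) ≡ - + 1 *ℤ altBinom a (suc i) +ℤ altBinom a i
altBinom-suc-suc a i = begin
  sgn (suc a +ℕ suc i) *ℤ + (suc a C suc i)
    ≡⟨ cong₂ (λ u v → - + 1 *ℤ sgn u *ℤ v) (NP.+-suc a i)
             (trans (cong +_ (sym (nCk+nC[k+1]≡[n+1]C[k+1] a i))) (ZP.pos-+ (a C i) (a C suc i))) ⟩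
  - + 1 *ℤ (- + 1 *ℤ s) *ℤ (+ (a C i) +ℤ + (a C suc i))
    ≡⟨ pascal s (+ (a C i)) (+ (a C suc i)) ⟩
  - + 1 *ℤ (- + 1 *ℤ s *ℤ + (a C suc i)) +ℤ s *ℤ + (a C i)
    ≡⟨ cong (λ u → - + 1 *ℤ (sgn u *ℤ + (a C suc i)) +ℤ s *ℤ + (a C i)) (sym (NP.+-suc a i)) ⟩
  - + 1 *ℤ altBinom a (suc i) +ℤ altBinom a i ∎
  where
  open ≡-Reasoning
  s = sgn (a +ℕ i)
  pascal : ∀ s c c′ → - + 1 *ℤ (- + 1 *ℤ s) *ℤ (c +ℤ c′) ≡ - + 1 *ℤ (- + 1 *ℤ s *ℤ c′) +ℤ s *ℤ c
  pascal = solve-∀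

xMinus1ˣ : PolyX
xMinus1ˣ = - + 1 ∷ + 1 ∷ []

coeffˣ-pow-xMinus1 : ∀ a i → coeffˣ (PX.powP xMinus1ˣ a) i ≡ altBinom a i
coeffˣ-pow-xMinus1 zero    zero    = refl
coeffˣ-pow-xMinus1 zero    (suc i) = sym (altBinom-zero-suc i)
coeffˣ-pow-xMinus1 (suc a) zero    = begin
  coeffˣ (PX.mulP xMinus1ˣ (PX.powP xMinus1ˣ a)) 0  ≡⟨ coeffˣ-mulP-zero (- + 1) (+ 1 ∷ []) (PX.powP xMinus1ˣ a) ⟩
  - + 1 *ℤ coeffˣ (PX.powP xMinus1ˣ a) 0             ≡⟨ cong (- + 1 *ℤ_) (coeffˣ-pow-xMinus1 a 0) ⟩
  - + 1 *ℤ altBinom a 0                              ≡⟨ sym (altBinom-suc-zero a) ⟩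
  altBinom (suc a) 0                                 ∎
  where open ≡-Reasoning
coeffˣ-pow-xMinus1 (suc a) (suc i) = begin
  coeffˣ (PX.mulP xMinus1ˣ p) (suc i)
    ≡⟨ coeffˣ-mulP-suc (- + 1) (+ 1 ∷ []) p i ⟩
  - + 1 *ℤ coeffˣ p (suc i) +ℤ coeffˣ (PX.mulP (+ 1 ∷ []) p) i
    ≡⟨ cong₂ _+ℤ_ (cong (- + 1 *ℤ_) (coeffˣ-pow-xMinus1 a (suc i)))
                  (trans (coeffˣ-mulP-constantˡ (+ 1) p i) (trans (ZP.*-identityˡ _) (coeffˣ-pow-xMinus1 a i))) ⟩
  - + 1 *ℤ altBinom a (suc i) +ℤ altBinom a i
    ≡⟨ sym (altBinom-suc-suc a i) ⟩
  altBinom (suc a) (suc i) ∎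
  where
  open ≡-Reasoning
  p = PX.powP xMinus1ˣ a

coeffˣʸ-addP : ∀ P Q i j → coeffˣʸ (PXY.addP P Q) i j ≡ coeffˣʸ P i j +ℤ coeffˣʸ Q i j
coeffˣʸ-addP []      Q       i j       = sym (ZP.+-identityˡ _)
coeffˣʸ-addP (p ∷ P) []      i j       = sym (ZP.+-identityʳ _)
coeffˣʸ-addP (p ∷ P) (q ∷ Q) i zero    = coeffˣ-addP p q i
coeffˣʸ-addP (p ∷ P) (q ∷ Q) i (suc j) = coeffˣʸ-addP P Q i j

coeffˣʸ-sum : ∀ Ps i j → coeffˣʸ (foldr PXY.addP [] Ps) i j ≡ ∑ Ps (λ P → coeffˣʸ P i j)
coeffˣʸ-sum []       i j = refl
coeffˣʸ-sum (P ∷ Ps) i j =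
  trans (coeffˣʸ-addP P (foldr PXY.addP [] Ps) i j) (cong (coeffˣʸ P i j +ℤ_) (coeffˣʸ-sum Ps i j))

coeffˣʸ-map-mulP : ∀ p Q i j → coeffˣʸ (map (PX.mulP p) Q) i j ≡ coeffˣ (PX.mulP p (PXY.coeffP Q j)) i
coeffˣʸ-map-mulP p []      i j       = sym (coeffˣ-mulP-[] p i)
coeffˣʸ-map-mulP p (q ∷ Q) i zero    = refl
coeffˣʸ-map-mulP p (q ∷ Q) i (suc j) = coeffˣʸ-map-mulP p Q i j

coeffˣʸ-mulP-zero : ∀ p P Q i → coeffˣʸ (PXY.mulP (p ∷ P) Q) i 0 ≡ coeffˣ (PX.mulP p (PXY.coeffP Q 0)) i
coeffˣʸ-mulP-zero p P Q i =
  trans (coeffˣʸ-addP (map (PX.mulP p) Q) ([] ∷ PXY.mulP P Q) i 0)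
        (trans (cong (_+ℤ + 0) (coeffˣʸ-map-mulP p Q i 0)) (ZP.+-identityʳ _))

coeffˣʸ-mulP-suc : ∀ p P Q i j →
  coeffˣʸ (PXY.mulP (p ∷ P) Q) i (suc j) ≡ coeffˣ (PX.mulP p (PXY.coeffP Q (suc j))) i +ℤ coeffˣʸ (PXY.mulP P Q) i j
coeffˣʸ-mulP-suc p P Q i j =
  trans (coeffˣʸ-addP (map (PX.mulP p) Q) ([] ∷ PXY.mulP P Q) i (suc j))
        (cong (_+ℤ coeffˣʸ (PXY.mulP P Q) i j) (coeffˣʸ-map-mulP p Q i (suc j)))

coeffˣʸ-mulP-constantˡ : ∀ p Q i j → coeffˣʸ (PXY.mulP (p ∷ []) Q) i j ≡ coeffˣ (PX.mulP p (PXY.coeffP Q j)) i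
coeffˣʸ-mulP-constantˡ p Q i zero    = coeffˣʸ-mulP-zero p [] Q i
coeffˣʸ-mulP-constantˡ p Q i (suc j) = trans (coeffˣʸ-mulP-suc p [] Q i j) (ZP.+-identityʳ _)

pow-xMinus1 : ∀ a → PXY.powP xMinus1 a ≡ PX.powP xMinus1ˣ a ∷ []
pow-xMinus1 zero    = refl
pow-xMinus1 (suc a) rewrite pow-xMinus1 a = cong (_∷ []) (addP-[]ʳ (PX.mulP xMinus1ˣ (PX.powP xMinus1ˣ a)))
  where
  addP-[]ʳ : ∀ p → PX.addP p [] ≡ p
  addP-[]ʳ []      = refl
  addP-[]ʳ (x ∷ p) = refl

coeffˣʸ-pow-yMinus1 : ∀ b i j → coeffˣʸ (PXY.powP yMinus1 b) i j ≡ coeffˣ (altBinom b j ∷ []) i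
coeffˣʸ-pow-yMinus1 zero    zero    zero    = refl
coeffˣʸ-pow-yMinus1 zero    (suc i) zero    = refl
coeffˣʸ-pow-yMinus1 zero    zero    (suc j) = sym (altBinom-zero-suc j)
coeffˣʸ-pow-yMinus1 zero    (suc i) (suc j) = refl
coeffˣʸ-pow-yMinus1 (suc b) i zero = begin
  coeffˣʸ (PXY.mulP yMinus1 Q) i 0                   ≡⟨ coeffˣʸ-mulP-zero (- + 1 ∷ []) ((+ 1 ∷ []) ∷ []) Q i ⟩
  coeffˣ (PX.mulP (- + 1 ∷ []) (PXY.coeffP Q 0)) i   ≡⟨ coeffˣ-mulP-constantˡ (- + 1) (PXY.coeffP Q 0) i ⟩
  - + 1 *ℤ coeffˣʸ Q i 0                             ≡⟨ cong (- + 1 *ℤ_) (coeffˣʸ-pow-yMinus1 b i 0) ⟩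
  - + 1 *ℤ coeffˣ (altBinom b 0 ∷ []) i              ≡⟨ sym (coeffˣ-scale (- + 1) (altBinom b 0 ∷ []) i) ⟩
  coeffˣ (- + 1 *ℤ altBinom b 0 ∷ []) i              ≡⟨ cong (λ c → coeffˣ (c ∷ []) i) (sym (altBinom-suc-zero b)) ⟩
  coeffˣ (altBinom (suc b) 0 ∷ []) i                 ∎
  where
  open ≡-Reasoning
  Q = PXY.powP yMinus1 b
coeffˣʸ-pow-yMinus1 (suc b) i (suc j) = begin
  coeffˣʸ (PXY.mulP yMinus1 Q) i (suc j)
    ≡⟨ coeffˣʸ-mulP-suc (- + 1 ∷ []) ((+ 1 ∷ []) ∷ []) Q i j ⟩
  coeffˣ (PX.mulP (- + 1 ∷ []) (PXY.coeffP Q (suc j))) i +ℤ coeffˣʸ (PXY.mulP ((+ 1 ∷ []) ∷ []) Q) i j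
    ≡⟨ cong₂ _+ℤ_ (coeffˣ-mulP-constantˡ (- + 1) (PXY.coeffP Q (suc j)) i)
                  (trans (coeffˣʸ-mulP-constantˡ (+ 1 ∷ []) Q i j)
                         (trans (coeffˣ-mulP-constantˡ (+ 1) (PXY.coeffP Q j) i) (ZP.*-identityˡ _))) ⟩
  - + 1 *ℤ coeffˣʸ Q i (suc j) +ℤ coeffˣʸ Q i j
    ≡⟨ cong₂ (λ u v → - + 1 *ℤ u +ℤ v) (coeffˣʸ-pow-yMinus1 b i (suc j)) (coeffˣʸ-pow-yMinus1 b i j) ⟩
  - + 1 *ℤ coeffˣ (altBinom b (suc j) ∷ []) i +ℤ coeffˣ (altBinom b j ∷ []) i
    ≡⟨ pascalAt i ⟩
  coeffˣ (altBinom (suc b) (suc j) ∷ []) i ∎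
  where
  open ≡-Reasoning
  Q = PXY.powP yMinus1 b
  pascalAt : ∀ i → - + 1 *ℤ coeffˣ (altBinom b (suc j) ∷ []) i +ℤ coeffˣ (altBinom b j ∷ []) i
                 ≡ coeffˣ (altBinom (suc b) (suc j) ∷ []) i
  pascalAt zero    = sym (altBinom-suc-suc b j)
  pascalAt (suc i) = refl

coeffˣʸ-monomial : ∀ a b i j →
  coeffˣʸ (PXY.mulP (PXY.powP xMinus1 a) (PXY.powP yMinus1 b)) i j ≡ altBinom a i *ℤ altBinom b j
coeffˣʸ-monomial a b i j rewrite pow-xMinus1 a = begin
  coeffˣʸ (PXY.mulP (PX.powP xMinus1ˣ a ∷ []) Q) i j
    ≡⟨ coeffˣʸ-mulP-constantˡ (PX.powP xMinus1ˣ a) Q i j ⟩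
  coeffˣ (PX.mulP (PX.powP xMinus1ˣ a) (PXY.coeffP Q j)) i
    ≡⟨ coeffˣ-mulP-constantʳ (PX.powP xMinus1ˣ a) (PXY.coeffP Q j) (λ k → coeffˣʸ-pow-yMinus1 b (suc k) j) i ⟩
  coeffˣ (PX.powP xMinus1ˣ a) i *ℤ coeffˣʸ Q 0 j
    ≡⟨ cong₂ _*ℤ_ (coeffˣ-pow-xMinus1 a i) (coeffˣʸ-pow-yMinus1 b 0 j) ⟩
  altBinom a i *ℤ altBinom b j ∎
  where
  open ≡-Reasoning
  Q = PXY.powP yMinus1 b

tutteCoeff-expansion : ∀ {n} (M : Matroid n) i j →
  tutteCoeff M i j ≡ ∑ (allSubsets n) (λ A → altBinom (rkM M ∸ rk M A) i *ℤ altBinom (∣ A ∣ ∸ rk M A) j)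
tutteCoeff-expansion {n} M i j = begin
  coeffˣʸ (foldr PXY.addP [] (map term S)) i j
    ≡⟨ coeffˣʸ-sum (map term S) i j ⟩
  ∑ (map term S) (λ P → coeffˣʸ P i j)
    ≡⟨ ∑-map term S (λ P → coeffˣʸ P i j) ⟩
  ∑ S (λ A → coeffˣʸ (term A) i j)
    ≡⟨ ∑-cong (λ A → coeffˣʸ-monomial (rkM M ∸ rk M A) (∣ A ∣ ∸ rk M A) i j) S ⟩
  ∑ S (λ A → altBinom (rkM M ∸ rk M A) i *ℤ altBinom (∣ A ∣ ∸ rk M A) j) ∎
  where
  open ≡-Reasoning
  S = allSubsets n
  term : Subset n → PolyXY
  term A = PXY.mulP (PXY.powP xMinus1 (rkM M ∸ rk M A)) (PXY.powP yMinus1 (∣ A ∣ ∸ rk M A))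

sgn-+ : ∀ a b → sgn (a +ℕ b) ≡ sgn a *ℤ sgn b
sgn-+ = ZP.^-distribˡ-+-* (- + 1)

sgn-double : ∀ k → sgn (k +ℕ k) ≡ + 1
sgn-double k = trans (sgn-+ k k) (square k)
  where
  square : ∀ k → sgn k *ℤ sgn k ≡ + 1
  square zero    = refl
  square (suc k) = trans (negate² (sgn k)) (square k)
    where
    negate² : ∀ s → (- + 1 *ℤ s) *ℤ (- + 1 *ℤ s) ≡ s *ℤ s
    negate² = solve-∀

sgn-shift : ∀ a b k i j → sgn (a +ℕ i) *ℤ sgn (b +ℕ j) ≡ sgn (a +ℕ k +ℕ i +ℕ j) *ℤ sgn (b +ℕ k)
sgn-shift a b k i j = begin
  sgn (a +ℕ i) *ℤ sgn (b +ℕ j)                      ≡⟨ sym (sgn-+ (a +ℕ i) (b +ℕ j)) ⟩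
  sgn (a +ℕ i +ℕ (b +ℕ j))                          ≡⟨ sym (ZP.*-identityʳ _) ⟩
  sgn (a +ℕ i +ℕ (b +ℕ j)) *ℤ + 1                   ≡⟨ cong (sgn (a +ℕ i +ℕ (b +ℕ j)) *ℤ_) (sym (sgn-double k)) ⟩
  sgn (a +ℕ i +ℕ (b +ℕ j)) *ℤ sgn (k +ℕ k)          ≡⟨ sym (sgn-+ (a +ℕ i +ℕ (b +ℕ j)) (k +ℕ k)) ⟩
  sgn (a +ℕ i +ℕ (b +ℕ j) +ℕ (k +ℕ k))              ≡⟨ cong sgn (rearrange a b k i j) ⟩
  sgn (a +ℕ k +ℕ i +ℕ j +ℕ (b +ℕ k))                ≡⟨ sgn-+ (a +ℕ k +ℕ i +ℕ j) (b +ℕ k) ⟩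
  sgn (a +ℕ k +ℕ i +ℕ j) *ℤ sgn (b +ℕ k)            ∎
  where
  open ≡-Reasoning
  rearrange : ∀ a b k i j → a +ℕ i +ℕ (b +ℕ j) +ℕ (k +ℕ k) ≡ a +ℕ k +ℕ i +ℕ j +ℕ (b +ℕ k)
  rearrange = ℕ-Solver.solve-∀

altBinom-product : ∀ {r s k} i j → k ≤ r → k ≤ s →
  altBinom (r ∸ k) i *ℤ altBinom (s ∸ k) j
    ≡ sgn (r +ℕ i +ℕ j) *ℤ (binomℤ (r ∸ k) i *ℤ (sgn s *ℤ binomℤ (s ∸ k) j))
altBinom-product {r} {s} {k} i j k≤r k≤s = begin
  (sgn (r ∸ k +ℕ i) *ℤ c) *ℤ (sgn (s ∸ k +ℕ j) *ℤ d)
    ≡⟨ gather (sgn (r ∸ k +ℕ i)) (sgn (s ∸ k +ℕ j)) c d ⟩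
  (sgn (r ∸ k +ℕ i) *ℤ sgn (s ∸ k +ℕ j)) *ℤ (c *ℤ d)
    ≡⟨ cong (_*ℤ (c *ℤ d)) (sgn-shift (r ∸ k) (s ∸ k) k i j) ⟩
  (sgn (r ∸ k +ℕ k +ℕ i +ℕ j) *ℤ sgn (s ∸ k +ℕ k)) *ℤ (c *ℤ d)
    ≡⟨ cong₂ (λ u v → (sgn (u +ℕ i +ℕ j) *ℤ sgn v) *ℤ (c *ℤ d)) (NP.m∸n+n≡m k≤r) (NP.m∸n+n≡m k≤s) ⟩
  (sgn (r +ℕ i +ℕ j) *ℤ sgn s) *ℤ (c *ℤ d)
    ≡⟨ scatter (sgn (r +ℕ i +ℕ j)) (sgn s) c d ⟩
  sgn (r +ℕ i +ℕ j) *ℤ (c *ℤ (sgn s *ℤ d)) ∎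
  where
  open ≡-Reasoning
  c = binomℤ (r ∸ k) i
  d = binomℤ (s ∸ k) j
  gather : ∀ p q c d → (p *ℤ c) *ℤ (q *ℤ d) ≡ (p *ℤ q) *ℤ (c *ℤ d)
  gather = solve-∀
  scatter : ∀ p q c d → (p *ℤ q) *ℤ (c *ℤ d) ≡ p *ℤ (c *ℤ (q *ℤ d))
  scatter = solve-∀

-- Regrouping subsets by the flats above them

∑-upper-sets : ∀ n (P : Subset n → Bool) (α c g : Subset n → ℤ) →
  (∀ A → ∑ (allSubsets n) (λ F → when (P F ∧ subB A F) (α F)) ≡ c A) →
  ∑ (filter (λ F → P F B.≟ true) (allSubsets n)) (λ F → α F *ℤ sumSubsetsOf F g)
    ≡ ∑ (allSubsets n) (λ A → c A *ℤ g A)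
∑-upper-sets n P α c g above = begin
  ∑ (filter (λ F → P F B.≟ true) S) (λ F → α F *ℤ sumSubsetsOf F g)
    ≡⟨ ∑-filter P _ S ⟩
  ∑ S (λ F → when (P F) (α F *ℤ sumSubsetsOf F g))
    ≡⟨ ∑-cong expand S ⟩
  ∑ S (λ F → ∑ S (λ A → when (P F) (when (subB A F) (α F *ℤ g A))))
    ≡⟨ ∑-swap S S _ ⟩
  ∑ S (λ A → ∑ S (λ F → when (P F) (when (subB A F) (α F *ℤ g A))))
    ≡⟨ ∑-cong collect S ⟩
  ∑ S (λ A → c A *ℤ g A) ∎
  where
  open ≡-Reasoning
  S = allSubsets n
  expand : ∀ F → when (P F) (α F *ℤ sumSubsetsOf F g) ≡ ∑ S (λ A → when (P F) (when (subB A F) (α F *ℤ g A)))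
  expand F = begin
    when (P F) (α F *ℤ sumSubsetsOf F g)
      ≡⟨ cong (λ z → when (P F) (α F *ℤ z)) (∑-filter (λ A → subB A F) g S) ⟩
    when (P F) (α F *ℤ ∑ S (λ A → when (subB A F) (g A)))
      ≡⟨ cong (when (P F)) (sym (∑-*ˡ (α F) _ S)) ⟩
    when (P F) (∑ S (λ A → α F *ℤ when (subB A F) (g A)))
      ≡⟨ when-∑ (P F) _ S ⟩
    ∑ S (λ A → when (P F) (α F *ℤ when (subB A F) (g A)))
      ≡⟨ ∑-cong (λ A → cong (when (P F)) (when-*ˡ (subB A F) (α F) (g A))) S ⟩
    ∑ S (λ A → when (P F) (when (subB A F) (α F *ℤ g A))) ∎
  collect : ∀ A → ∑ S (λ F → when (P F) (when (subB A F) (α F *ℤ g A))) ≡ c A *ℤ g A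
  collect A = begin
    ∑ S (λ F → when (P F) (when (subB A F) (α F *ℤ g A)))
      ≡⟨ ∑-cong (λ F → trans (when-∧ (P F) (subB A F) _) (sym (when-*ʳ (P F ∧ subB A F) (α F) (g A)))) S ⟩
    ∑ S (λ F → when (P F ∧ subB A F) (α F) *ℤ g A)
      ≡⟨ ∑-*ʳ (g A) _ S ⟩
    ∑ S (λ F → when (P F ∧ subB A F) (α F)) *ℤ g A
      ≡⟨ cong (_*ℤ g A) (above A) ⟩
    c A *ℤ g A ∎

corollary4p1 : (n : ℕ) (M : Matroid n) → Loopless M →
    (μ : Subset n → Subset n → Subset n → ℤ) → IsMobius M μ →
    (i j : ℕ) →
    tutteCoeff M i j ≡
      sgn (rkM M +ℕ i +ℕ j) *ℤ
      sumℤ (map (λ F →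
          sumℤ (map (λ F' → μ F ⊥ F' *ℤ binomℤ (rkM M ∸ rk M (F ∪ F')) i) (flatsC M F))
          *ℤ sumSubsetsOf F (λ A → sgn ∣ A ∣ *ℤ binomℤ (∣ A ∣ ∸ rk M A) j))
        (flats M))
corollary4p1 n M _ μ isMöbius i j = begin
  tutteCoeff M i j
    ≡⟨ tutteCoeff-expansion M i j ⟩
  ∑ S (λ A → altBinom (rkM M ∸ rk M A) i *ℤ altBinom (∣ A ∣ ∸ rk M A) j)
    ≡⟨ ∑-cong (λ A → altBinom-product i j (rk≤rkM A) (rk-card M A)) S ⟩
  ∑ S (λ A → sign *ℤ (c A *ℤ g A))
    ≡⟨ ∑-*ˡ sign _ S ⟩
  sign *ℤ ∑ S (λ A → c A *ℤ g A)
    ≡⟨ cong (sign *ℤ_) (sym (∑-upper-sets n (isFlat M) α c g above)) ⟩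
  sign *ℤ ∑ (flats M) (λ F → α F *ℤ sumSubsetsOf F g) ∎
  where
  open ≡-Reasoning
  open Flats M
  open FlatMöbius M μ isMöbius
  S = allSubsets n
  sign = sgn (rkM M +ℕ i +ℕ j)
  c g α : Subset n → ℤ
  c H = binomℤ (rkM M ∸ rk M H) i
  g A = sgn ∣ A ∣ *ℤ binomℤ (∣ A ∣ ∸ rk M A) j
  α F = ∑ (flatsC M F) (λ G → μ F ⊥ G *ℤ c (F ∪ G))
  above : ∀ A → ∑ S (λ F → when (isFlat M F ∧ subB A F) (α F)) ≡ c A
  above A = trans (∑-flats-above A c) (cong (λ r → binomℤ (rkM M ∸ r) i) (rk-cl A))
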